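{- In the HyLL sequent calculus (described in the context): (1) If $\Gamma;\Delta\Longrightarrow A@u$ and $\Gamma;\Delta',A@u\Longrightarrow C@w$ are derivable, then $\Gamma;\Delta,\Delta'\Longrightarrow C@w$ is derivable. (2) If $\Gamma;\cdot\Longrightarrow A@u$ and $\Gamma,A@u;\Delta\Longrightarrow C@w$ are derivable, then $\Gamma;\Delta\Longrightarrow C@w$ is derivable.
   Context: Fix a constraint domain, i.e. a monoid $\mathcal W=\langle W,\cdot,\iota\rangle$ whose elements are called worlds. World expressions $u,v,w$ are built from world variables and elements of $W$ using $\cdot$; terms are built from term variables and function symbols. HyLL propositions are $A,B::= a\,\vec t \mid A\otimes B\mid \mathbf 1\mid A\multimap B\mid A\,\&\,B\mid\top\mid A\oplus B\mid \mathbf 0\mid\, !A\mid \forall x.A\mid\exists x.A\mid (A\ \mathrm{at}\ w)\mid \downarrow u.A\mid\forall u.A\mid \exists u.A$, with $a$ a predicate symbol applied to terms, $x$ a term variable, $u$ a world variable ($\downarrow u$, $\forall u$, $\exists u$ bind $u$). $\alpha$ ranges over variables of either kind, $\tau$ over terms or world expressions accordingly, $[\tau/\alpha]A$ is capture-avoiding substitution, and propositions are identified up to $\alpha$-conversion. A judgement is $A@w$. Sequents have the form $\Gamma;\Delta\Longrightarrow C@w$ with $\Gamma$ a set (unrestricted context) and $\Delta$ a multiset (linear context) of judgements. The derivable sequents are generated by the rules (premises $\Rightarrow$ conclusion); note there is no cut rule among them: init: $\Gamma;a\,\vec t@u\Longrightarrow a\,\vec t@u$; copy: from $\Gamma,A@u;\Delta,A@u\Longrightarrow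 C@w$ infer $\Gamma,A@u;\Delta\Longrightarrow C@w$; $\otimes$R: from $\Gamma;\Delta\Longrightarrow A@w$ and $\Gamma;\Delta'\Longrightarrow B@w$ infer $\Gamma;\Delta,\Delta'\Longrightarrow A\otimes B@w$; $\otimes$L: from $\Gamma;\Delta,A@u,B@u\Longrightarrow C@w$ infer $\Gamma;\Delta,A\otimes B@u\Longrightarrow C@w$; $\mathbf1$R: $\Gamma;\cdot\Longrightarrow\mathbf1@w$; $\mathbf1$L: from $\Gamma;\Delta\Longrightarrow C@w$ infer $\Gamma;\Delta,\mathbf1@u\Longrightarrow C@w$; $\multimap$R: from $\Gamma;\Delta,A@w\Longrightarrow B@w$ infer $\Gamma;\Delta\Longrightarrow A\multimap B@w$; $\multimap$L: from $\Gamma;\Delta\Longrightarrow A@u$ and $\Gamma;\Delta',B@u\Longrightarrow C@w$ infer $\Gamma;\Delta,\Delta',A\multimap B@u\Longrightarrow C@w$; $\top$R: $\Gamma;\Delta\Longrightarrow\top@w$; $\&$R: from $\Gamma;\Delta\Longrightarrow A@w$ and $\Gamma;\Delta\Longrightarrow B@w$ infer $\Gamma;\Delta\Longrightarrow A\&B@w$; $\&$L$_i$: from $\Gamma;\Delta,A_i@u\Longrightarrow C@w$ infer $\Gamma;\Delta,A_1\&A_2@u\Longrightarrow C@w$; $\oplus$R$_i$: from $\Gamma;\Delta\Longrightarrow A_i@w$ infer $\Gamma;\Delta\Longrightarrow A_1\oplus A_2@w$; $\oplus$L: from $\Gamma;\Delta,A@u\Longrightarrow C@w$ and $\Gamma;\Delta,B@u\Longrightarrow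 C@w$ infer $\Gamma;\Delta,A\oplus B@u\Longrightarrow C@w$; $\mathbf0$L: $\Gamma;\Delta,\mathbf0@u\Longrightarrow C@w$; $\forall$R: from $\Gamma;\Delta\Longrightarrow A@w$ infer $\Gamma;\Delta\Longrightarrow\forall\alpha.A@w$ ($\alpha$ fresh for the conclusion); $\forall$L: from $\Gamma;\Delta,[\tau/\alpha]A@u\Longrightarrow C@w$ infer $\Gamma;\Delta,\forall\alpha.A@u\Longrightarrow C@w$; $\exists$R: from $\Gamma;\Delta\Longrightarrow[\tau/\alpha]A@w$ infer $\Gamma;\Delta\Longrightarrow\exists\alpha.A@w$; $\exists$L: from $\Gamma;\Delta,A@u\Longrightarrow C@w$ infer $\Gamma;\Delta,\exists\alpha.A@u\Longrightarrow C@w$ ($\alpha$ fresh for the conclusion); !R: from $\Gamma;\cdot\Longrightarrow A@w$ infer $\Gamma;\cdot\Longrightarrow !A@w$; !L: from $\Gamma,A@u;\Delta\Longrightarrow C@w$ infer $\Gamma;\Delta,!A@u\Longrightarrow C@w$; at R: from $\Gamma;\Delta\Longrightarrow A@u$ infer $\Gamma;\Delta\Longrightarrow(A\ \mathrm{at}\ u)@v$; at L: from $\Gamma;\Delta,A@u\Longrightarrow C@w$ infer $\Gamma;\Delta,(A\ \mathrm{at}\ u)@v\Longrightarrow C@w$; $\downarrow$R: from $\Gamma;\Delta\Longrightarrow[w/u]A@w$ infer $\Gamma;\Delta\Longrightarrow\downarrow u.A@w$; $\downarrow$L: from $\Gamma;\Delta,[v/u]A@v\Longrightarrow C@w$ infer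 $\Gamma;\Delta,\downarrow u.A@v\Longrightarrow C@w$. -}

module Defs where

open import Level using (Level; _⊔_)
open import Data.Nat using (ℕ; zero; suc)
open import Data.Fin using (Fin; zero; suc)
open import Data.Vec using (Vec; []; _∷_)
open import Data.List using (List; []; _∷_; _++_; map)
open import Data.List.Membership.Propositional using (_∈_)
open import Data.List.Relation.Binary.Permutation.Propositional using (_↭_)
open import Algebra.Bundles using (Monoid)

record Signature : Set₁ where
  field
    FSym   : Set
    farity : FSym → ℕ
    PSym   : Set
    parity : PSym → ℕ

-- Syntax is scoped de Bruijn: Term m has m free term variables,
-- World k has k free world variables, Prop m k both.  Hence
-- α-equivalent propositions are literally equal.
module HyLL {c ℓ : Level} (𝒲 : Monoid c ℓ) (Sg : Signature) where
  open Signature Sg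
  open Monoid 𝒲 using (Carrier)

  data Term (m : ℕ) : Set where
    var : Fin m → Term m
    fn  : (f : FSym) → Vec (Term m) (farity f) → Term m

  mutual
    substT : ∀ {m n} → (Fin m → Term n) → Term m → Term n
    substT σ (var i)  = σ i
    substT σ (fn f ts) = fn f (substTs σ ts)

    substTs : ∀ {m n l} → (Fin m → Term n) → Vec (Term m) l → Vec (Term n) l
    substTs σ []       = []
    substTs σ (t ∷ ts) = substT σ t ∷ substTs σ ts

  liftT : ∀ {m n} → (Fin m → Term n) → Fin (suc m) → Term (suc n)
  liftT σ zero    = var zero
  liftT σ (suc i) = substT (λ j → var (suc j)) (σ i)

  sub0T : ∀ {m} → Term m → Fin (suc m) → Term m
  sub0T t zero    = t
  sub0T t (suc i) = var i

  data World (k : ℕ) : Set c where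
    wvar  : Fin k → World k
    const : Carrier → World k
    _·_   : World k → World k → World k

  substW : ∀ {k l} → (Fin k → World l) → World k → World l
  substW τ (wvar i)  = τ i
  substW τ (const a) = const a
  substW τ (u · v)   = substW τ u · substW τ v

  liftW : ∀ {k l} → (Fin k → World l) → Fin (suc k) → World (suc l)
  liftW τ zero    = wvar zero
  liftW τ (suc i) = substW (λ j → wvar (suc j)) (τ i)

  sub0W : ∀ {k} → World k → Fin (suc k) → World k
  sub0W w zero    = w
  sub0W w (suc i) = wvar i

  infixr 9 _⊗_
  infixr 8 _⊸_
  infixr 9 _&_
  infixr 9 _⊕_
  data Prop (m k : ℕ) : Set c where
    atom : (p : PSym) → Vec (Term m) (parity p) → Prop m k
    _⊗_  : Prop m k → Prop m k → Prop m k
    𝟏    : Prop m k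
    _⊸_  : Prop m k → Prop m k → Prop m k
    _&_  : Prop m k → Prop m k → Prop m k
    ⊤'   : Prop m k
    _⊕_  : Prop m k → Prop m k → Prop m k
    𝟎    : Prop m k
    !_   : Prop m k → Prop m k
    ∀t   : Prop (suc m) k → Prop m k
    ∃t   : Prop (suc m) k → Prop m k
    _at_ : Prop m k → World k → Prop m k
    ↓_   : Prop m (suc k) → Prop m k
    ∀w   : Prop m (suc k) → Prop m k
    ∃w   : Prop m (suc k) → Prop m k

  substP : ∀ {m m' k k'} → (Fin m → Term m') → (Fin k → World k')
         → Prop m k → Prop m' k'
  substP σ τ (atom p ts) = atom p (substTs σ ts)
  substP σ τ (A ⊗ B)     = substP σ τ A ⊗ substP σ τ B
  substP σ τ 𝟏           = 𝟏
  substP σ τ (A ⊸ B)     = substP σ τ A ⊸ substP σ τ B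
  substP σ τ (A & B)     = substP σ τ A & substP σ τ B
  substP σ τ ⊤'          = ⊤'
  substP σ τ (A ⊕ B)     = substP σ τ A ⊕ substP σ τ B
  substP σ τ 𝟎           = 𝟎
  substP σ τ (! A)       = ! substP σ τ A
  substP σ τ (∀t A)      = ∀t (substP (liftT σ) τ A)
  substP σ τ (∃t A)      = ∃t (substP (liftT σ) τ A)
  substP σ τ (A at w)    = substP σ τ A at substW τ w
  substP σ τ (↓ A)       = ↓ substP σ (liftW τ) A
  substP σ τ (∀w A)      = ∀w (substP σ (liftW τ) A)
  substP σ τ (∃w A)      = ∃w (substP σ (liftW τ) A)

  _[_/x] : ∀ {m k} → Prop (suc m) k → Term m → Prop m k
  A [ t /x] = substP (sub0T t) wvar A

  _[_/u] : ∀ {m k} → Prop m (suc k) → World k → Prop m k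
  A [ w /u] = substP var (sub0W w) A

  infix 7 _＠_
  data Judg (m k : ℕ) : Set c where
    _＠_ : Prop m k → World k → Judg m k

  wkJt : ∀ {m k} → Judg m k → Judg (suc m) k
  wkJt (A ＠ u) = substP (λ i → var (suc i)) wvar A ＠ u

  wkJw : ∀ {m k} → Judg m k → Judg m (suc k)
  wkJw (A ＠ u) = substP var (λ i → wvar (suc i)) A ＠ substW (λ i → wvar (suc i)) u

  -- Sequents  Γ ⨾ Δ ⟹ C @ w  (cut-free HyLL sequent calculus).
  -- Γ is read as a set (only membership and extension are used),
  -- Δ as a multiset (the rule `exch` identifies permuted lists).
  infix 2 _⨾_⟹_
  data _⨾_⟹_ {m k : ℕ} : List (Judg m k) → List (Judg m k) → Judg m k → Set c where
    exch : ∀ {Γ Δ Δ' J} → Δ ↭ Δ' → Γ ⨾ Δ ⟹ J → Γ ⨾ Δ' ⟹ J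
    init : ∀ {Γ p ts u} → Γ ⨾ (atom p ts ＠ u ∷ []) ⟹ atom p ts ＠ u
    copy : ∀ {Γ Δ A u J} → (A ＠ u) ∈ Γ → Γ ⨾ (A ＠ u ∷ Δ) ⟹ J → Γ ⨾ Δ ⟹ J
    ⊗R : ∀ {Γ Δ Δ' A B w} → Γ ⨾ Δ ⟹ A ＠ w → Γ ⨾ Δ' ⟹ B ＠ w
       → Γ ⨾ Δ ++ Δ' ⟹ A ⊗ B ＠ w
    ⊗L : ∀ {Γ Δ A B u J} → Γ ⨾ (A ＠ u ∷ B ＠ u ∷ Δ) ⟹ J
       → Γ ⨾ (A ⊗ B ＠ u ∷ Δ) ⟹ J
    𝟏R : ∀ {Γ w} → Γ ⨾ [] ⟹ 𝟏 ＠ w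
    𝟏L : ∀ {Γ Δ u J} → Γ ⨾ Δ ⟹ J → Γ ⨾ (𝟏 ＠ u ∷ Δ) ⟹ J
    ⊸R : ∀ {Γ Δ A B w} → Γ ⨾ (A ＠ w ∷ Δ) ⟹ B ＠ w → Γ ⨾ Δ ⟹ A ⊸ B ＠ w
    ⊸L : ∀ {Γ Δ Δ' A B u J} → Γ ⨾ Δ ⟹ A ＠ u → Γ ⨾ (B ＠ u ∷ Δ') ⟹ J
       → Γ ⨾ (A ⊸ B ＠ u ∷ Δ ++ Δ') ⟹ J
    ⊤R : ∀ {Γ Δ w} → Γ ⨾ Δ ⟹ ⊤' ＠ w
    &R : ∀ {Γ Δ A B w} → Γ ⨾ Δ ⟹ A ＠ w → Γ ⨾ Δ ⟹ B ＠ w → Γ ⨾ Δ ⟹ A & B ＠ w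
    &L₁ : ∀ {Γ Δ A B u J} → Γ ⨾ (A ＠ u ∷ Δ) ⟹ J → Γ ⨾ (A & B ＠ u ∷ Δ) ⟹ J
    &L₂ : ∀ {Γ Δ A B u J} → Γ ⨾ (B ＠ u ∷ Δ) ⟹ J → Γ ⨾ (A & B ＠ u ∷ Δ) ⟹ J
    ⊕R₁ : ∀ {Γ Δ A B w} → Γ ⨾ Δ ⟹ A ＠ w → Γ ⨾ Δ ⟹ A ⊕ B ＠ w
    ⊕R₂ : ∀ {Γ Δ A B w} → Γ ⨾ Δ ⟹ B ＠ w → Γ ⨾ Δ ⟹ A ⊕ B ＠ w
    ⊕L : ∀ {Γ Δ A B u J} → Γ ⨾ (A ＠ u ∷ Δ) ⟹ J → Γ ⨾ (B ＠ u ∷ Δ) ⟹ J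
       → Γ ⨾ (A ⊕ B ＠ u ∷ Δ) ⟹ J
    𝟎L : ∀ {Γ Δ u J} → Γ ⨾ (𝟎 ＠ u ∷ Δ) ⟹ J
    ∀tR : ∀ {Γ Δ A w} → map wkJt Γ ⨾ map wkJt Δ ⟹ A ＠ w → Γ ⨾ Δ ⟹ ∀t A ＠ w
    ∀tL : ∀ {Γ Δ A u J} (t : Term m) → Γ ⨾ (A [ t /x] ＠ u ∷ Δ) ⟹ J
        → Γ ⨾ (∀t A ＠ u ∷ Δ) ⟹ J
    ∃tR : ∀ {Γ Δ A w} (t : Term m) → Γ ⨾ Δ ⟹ A [ t /x] ＠ w → Γ ⨾ Δ ⟹ ∃t A ＠ w
    ∃tL : ∀ {Γ Δ A u C w} → map wkJt Γ ⨾ (A ＠ u ∷ map wkJt Δ) ⟹ wkJt (C ＠ w)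
        → Γ ⨾ (∃t A ＠ u ∷ Δ) ⟹ C ＠ w
    ∀wR : ∀ {Γ Δ A w} → map wkJw Γ ⨾ map wkJw Δ
                          ⟹ A ＠ substW (λ i → wvar (suc i)) w
        → Γ ⨾ Δ ⟹ ∀w A ＠ w
    ∀wL : ∀ {Γ Δ A u J} (v : World k) → Γ ⨾ (A [ v /u] ＠ u ∷ Δ) ⟹ J
        → Γ ⨾ (∀w A ＠ u ∷ Δ) ⟹ J
    ∃wR : ∀ {Γ Δ A w} (v : World k) → Γ ⨾ Δ ⟹ A [ v /u] ＠ w → Γ ⨾ Δ ⟹ ∃w A ＠ w
    ∃wL : ∀ {Γ Δ A u C w}
        → map wkJw Γ ⨾ (A ＠ substW (λ i → wvar (suc i)) u ∷ map wkJw Δ) ⟹ wkJw (C ＠ w)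
        → Γ ⨾ (∃w A ＠ u ∷ Δ) ⟹ C ＠ w
    !R : ∀ {Γ A w} → Γ ⨾ [] ⟹ A ＠ w → Γ ⨾ [] ⟹ ! A ＠ w
    !L : ∀ {Γ Δ A u J} → (A ＠ u ∷ Γ) ⨾ Δ ⟹ J → Γ ⨾ (! A ＠ u ∷ Δ) ⟹ J
    atR : ∀ {Γ Δ A u v} → Γ ⨾ Δ ⟹ A ＠ u → Γ ⨾ Δ ⟹ (A at u) ＠ v
    atL : ∀ {Γ Δ A u v J} → Γ ⨾ (A ＠ u ∷ Δ) ⟹ J → Γ ⨾ ((A at u) ＠ v ∷ Δ) ⟹ J
    ↓R : ∀ {Γ Δ A w} → Γ ⨾ Δ ⟹ A [ w /u] ＠ w → Γ ⨾ Δ ⟹ ↓ A ＠ w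
    ↓L : ∀ {Γ Δ A v J} → Γ ⨾ (A [ v /u] ＠ v ∷ Δ) ⟹ J → Γ ⨾ (↓ A ＠ v ∷ Δ) ⟹ J

module Submission where

-- The proof is the usual triple induction: on the size of the cut formula, then on the
-- right premise (commuting the cut upwards until the cut formula is principal there),
-- then on the left premise (commuting until it ends in the matching right rule, where a
-- principal reduction replaces the cut by cuts on smaller formulas).  Two features of
-- HyLL shape the development.
--  * Quantifier rules weaken contexts and instantiate eigenvariables, so a premise is
--    not cut as such but under a simultaneous substitution θ of terms and worlds that
--    embeds its unrestricted context into the common one; recursion stays structural.
--    This needs the substitution metatheory (Syntax) and the substitution lemma for
--    derivations (Derivations).
--  * The reduction for !A cuts a hypothesis out of the unrestricted context.  This is the
--    same substitution traversal, with "usable hypothesis" generalised from membership to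
--    "member, or derivable with a smaller cut formula" (HypStructure, CutHyp); each copy
--    of such a hypothesis becomes a linear cut at smaller size.

open import Level using (Level)
open import Data.Empty using (⊥-elim)
open import Data.Nat using (ℕ; suc; _+_; _≤_; s≤s)
open import Data.Nat.Properties using (m+n≤o⇒m≤o; m+n≤o⇒n≤o; ≤-refl)
open import Data.Fin using (Fin; zero; suc)
open import Data.Vec using (Vec; []; _∷_)
open import Data.List using (List; []; _∷_; _++_; map)
open import Data.List.Properties using (map-∘; map-cong; map-id; map-++; ++-assoc; ++-identityʳ)
open import Data.List.Membership.Propositional using (_∈_)
open import Data.List.Membership.Propositional.Properties using (∈-∃++; ∈-++⁻; ∈-map⁺; ∈-map⁻)
open import Data.List.Relation.Unary.Any using (here; there)
open import Data.List.Relation.Binary.Permutation.Propositional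
  using (_↭_; ↭-refl; ↭-reflexive; ↭-sym; ↭-trans; prep; swap)
open import Data.List.Relation.Binary.Permutation.Propositional.Properties
  using (map⁺; shift; shifts; ++⁺ˡ; ++⁺ʳ; drop-∷; ∈-resp-↭; ¬x∷xs↭[]; ↭-singleton-inv)
open import Data.Product using (Σ; _×_; _,_)
open import Data.Sum using (_⊎_; inj₁; inj₂)
open import Relation.Nullary using (¬_)
open import Relation.Binary.PropositionalEquality
  using (_≡_; refl; sym; trans; cong; cong₂; subst)
open import Algebra.Bundles using (Monoid)
open import Defs

map-commute : ∀ {a b d e} {A : Set a} {B : Set b} {D : Set d} {E : Set e}
                {f : B → D} {g : A → B} {f' : E → D} {g' : A → E}
            → (∀ x → f (g x) ≡ f' (g' x)) → ∀ xs → map f (map g xs) ≡ map f' (map g' xs)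
map-commute e xs = trans (sym (map-∘ xs)) (trans (map-cong e xs) (map-∘ xs))

map-fuse : ∀ {a b d} {A : Set a} {B : Set b} {D : Set d} {f : A → D} {g : B → D} {h : A → B}
         → (∀ x → f x ≡ g (h x)) → ∀ xs → map f xs ≡ map g (map h xs)
map-fuse e xs = trans (map-cong e xs) (map-∘ xs)

map-inverse : ∀ {a b} {A : Set a} {B : Set b} {f : B → A} {g : A → B}
            → (∀ x → f (g x) ≡ x) → ∀ xs → map f (map g xs) ≡ xs
map-inverse e xs = trans (sym (map-∘ xs)) (trans (map-cong e xs) (map-id xs))

module Permutation {a} {X : Set a} where

  ∈⇒↭∷ : ∀ {x : X} {xs} → x ∈ xs → Σ (List X) λ R → xs ↭ x ∷ R
  ∈⇒↭∷ {x} x∈xs with ∈-∃++ x∈xs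
  ... | ys , zs , refl = ys ++ zs , shift x ys zs

  ↭-head : ∀ {x a : X} {xs R} → x ∷ xs ↭ a ∷ R
         → (x ≡ a × xs ↭ R) ⊎ Σ (List X) (λ R' → xs ↭ a ∷ R' × R ↭ x ∷ R')
  ↭-head {x} {a} p with ∈-resp-↭ (↭-sym p) (here refl)
  ... | here refl = inj₁ (refl , drop-∷ p)
  ... | there a∈xs with ∈⇒↭∷ a∈xs
  ...   | R' , q = inj₂ (R' , q , ↭-sym (drop-∷ (↭-trans (swap a x ↭-refl) (↭-trans (prep x (↭-sym q)) p))))

  ↭-split++ : ∀ (xs : List X) {ys a R} → xs ++ ys ↭ a ∷ R
            → Σ (List X) (λ R₁ → xs ↭ a ∷ R₁ × R ↭ R₁ ++ ys)
            ⊎ Σ (List X) (λ R₂ → ys ↭ a ∷ R₂ × R ↭ xs ++ R₂)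
  ↭-split++ xs {ys} {a} p with ∈-++⁻ xs (∈-resp-↭ (↭-sym p) (here refl))
  ... | inj₁ a∈xs with ∈⇒↭∷ a∈xs
  ...   | R₁ , q = inj₁ (R₁ , q , ↭-sym (drop-∷ (↭-trans (↭-sym (++⁺ʳ ys q)) p)))
  ↭-split++ xs {ys} {a} {R} p | inj₂ a∈ys with ∈⇒↭∷ a∈ys
  ...   | R₂ , q = inj₂ (R₂ , q , ↭-sym (drop-∷ (↭-trans (↭-sym (shift a xs R₂)) (↭-trans (++⁺ˡ xs (↭-sym q)) p))))

  ¬[]↭∷ : ∀ {a : X} {R} → ¬ ([] ↭ a ∷ R)
  ¬[]↭∷ p = ¬x∷xs↭[] (↭-sym p)

  ↭-singleton : ∀ {x a : X} {R} → x ∷ [] ↭ a ∷ R → x ≡ a × R ≡ []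
  ↭-singleton p with ↭-singleton-inv (↭-sym p)
  ... | refl = refl , refl

  ↭-under : ∀ (x : X) {L a R'} → L ↭ a ∷ R' → x ∷ L ↭ a ∷ x ∷ R'
  ↭-under x {a = a} q = ↭-trans (prep x q) (swap x a ↭-refl)

  ↭-under₂ : ∀ (x y : X) {L a R'} → L ↭ a ∷ R' → x ∷ y ∷ L ↭ a ∷ x ∷ y ∷ R'
  ↭-under₂ x y {a = a} q = ↭-trans (prep x (↭-under y q)) (swap x a ↭-refl)

  shift₂ : ∀ (D : List X) x y R → D ++ x ∷ y ∷ R ↭ x ∷ y ∷ (D ++ R)
  shift₂ D x y R = ↭-trans (shift x D (y ∷ R)) (prep x (shift y D R))

  ↭-restore : ∀ (D : List X) {x R' Rest} → Rest ↭ x ∷ R' → x ∷ (D ++ R') ↭ D ++ Rest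
  ↭-restore D {x} {R'} q = ↭-trans (↭-sym (shift x D R')) (++⁺ˡ D (↭-sym q))

  ↭-assoc : ∀ (xs ys zs : List X) → (xs ++ ys) ++ zs ↭ xs ++ (ys ++ zs)
  ↭-assoc xs ys zs = ↭-reflexive (++-assoc xs ys zs)

module Syntax {c ℓ : Level} (𝒲 : Monoid c ℓ) (Sg : Signature) where
  open HyLL 𝒲 Sg

  mutual
    substT-cong : ∀ {m n} {σ σ' : Fin m → Term n} → (∀ i → σ i ≡ σ' i) → ∀ t → substT σ t ≡ substT σ' t
    substT-cong h (var i)   = h i
    substT-cong h (fn f ts) = cong (fn f) (substTs-cong h ts)

    substTs-cong : ∀ {m n l} {σ σ' : Fin m → Term n} → (∀ i → σ i ≡ σ' i)
                 → (ts : Vec (Term m) l) → substTs σ ts ≡ substTs σ' ts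
    substTs-cong h []       = refl
    substTs-cong h (t ∷ ts) = cong₂ _∷_ (substT-cong h t) (substTs-cong h ts)

  mutual
    substT-comp : ∀ {m n l} (σ : Fin m → Term n) (σ' : Fin n → Term l) t
                → substT σ' (substT σ t) ≡ substT (λ i → substT σ' (σ i)) t
    substT-comp σ σ' (var i)   = refl
    substT-comp σ σ' (fn f ts) = cong (fn f) (substTs-comp σ σ' ts)

    substTs-comp : ∀ {m n l j} (σ : Fin m → Term n) (σ' : Fin n → Term l) (ts : Vec (Term m) j)
                 → substTs σ' (substTs σ ts) ≡ substTs (λ i → substT σ' (σ i)) ts
    substTs-comp σ σ' []       = refl
    substTs-comp σ σ' (t ∷ ts) = cong₂ _∷_ (substT-comp σ σ' t) (substTs-comp σ σ' ts)

  mutual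
    substT-id : ∀ {m} (t : Term m) → substT var t ≡ t
    substT-id (var i)   = refl
    substT-id (fn f ts) = cong (fn f) (substTs-id ts)

    substTs-id : ∀ {m l} (ts : Vec (Term m) l) → substTs var ts ≡ ts
    substTs-id []       = refl
    substTs-id (t ∷ ts) = cong₂ _∷_ (substT-id t) (substTs-id ts)

  substW-cong : ∀ {k l} {τ τ' : Fin k → World l} → (∀ i → τ i ≡ τ' i) → ∀ w → substW τ w ≡ substW τ' w
  substW-cong h (wvar i)  = h i
  substW-cong h (const a) = refl
  substW-cong h (u · v)   = cong₂ _·_ (substW-cong h u) (substW-cong h v)

  substW-comp : ∀ {k l j} (τ : Fin k → World l) (τ' : Fin l → World j) w
              → substW τ' (substW τ w) ≡ substW (λ i → substW τ' (τ i)) w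
  substW-comp τ τ' (wvar i)  = refl
  substW-comp τ τ' (const a) = refl
  substW-comp τ τ' (u · v)   = cong₂ _·_ (substW-comp τ τ' u) (substW-comp τ τ' v)

  substW-id : ∀ {k} (w : World k) → substW wvar w ≡ w
  substW-id (wvar i)  = refl
  substW-id (const a) = refl
  substW-id (u · v)   = cong₂ _·_ (substW-id u) (substW-id v)

  liftT-cong : ∀ {m n} {σ σ' : Fin m → Term n} → (∀ i → σ i ≡ σ' i) → ∀ i → liftT σ i ≡ liftT σ' i
  liftT-cong h zero    = refl
  liftT-cong h (suc i) = cong (substT (λ j → var (suc j))) (h i)

  liftW-cong : ∀ {k l} {τ τ' : Fin k → World l} → (∀ i → τ i ≡ τ' i) → ∀ i → liftW τ i ≡ liftW τ' i
  liftW-cong h zero    = refl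
  liftW-cong h (suc i) = cong (substW (λ j → wvar (suc j))) (h i)

  liftT-comp : ∀ {m n l} (σ : Fin m → Term n) (σ' : Fin n → Term l) i
             → substT (liftT σ') (liftT σ i) ≡ liftT (λ j → substT σ' (σ j)) i
  liftT-comp σ σ' zero    = refl
  liftT-comp σ σ' (suc i) =
    trans (substT-comp (λ j → var (suc j)) (liftT σ') (σ i)) (sym (substT-comp σ' (λ j → var (suc j)) (σ i)))

  liftW-comp : ∀ {k l j} (τ : Fin k → World l) (τ' : Fin l → World j) i
             → substW (liftW τ') (liftW τ i) ≡ liftW (λ j → substW τ' (τ j)) i
  liftW-comp τ τ' zero    = refl
  liftW-comp τ τ' (suc i) =
    trans (substW-comp (λ j → wvar (suc j)) (liftW τ') (τ i)) (sym (substW-comp τ' (λ j → wvar (suc j)) (τ i)))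

  liftT-id : ∀ {m} (i : Fin (suc m)) → liftT var i ≡ var i
  liftT-id zero    = refl
  liftT-id (suc i) = refl

  liftW-id : ∀ {k} (i : Fin (suc k)) → liftW wvar i ≡ wvar i
  liftW-id zero    = refl
  liftW-id (suc i) = refl

  substP-cong : ∀ {m m' k k'} {σ σ' : Fin m → Term m'} {τ τ' : Fin k → World k'}
              → (∀ i → σ i ≡ σ' i) → (∀ i → τ i ≡ τ' i) → ∀ A → substP σ τ A ≡ substP σ' τ' A
  substP-cong hs ht (atom p ts) = cong (atom p) (substTs-cong hs ts)
  substP-cong hs ht (A ⊗ B)     = cong₂ _⊗_ (substP-cong hs ht A) (substP-cong hs ht B)
  substP-cong hs ht 𝟏           = refl
  substP-cong hs ht (A ⊸ B)     = cong₂ _⊸_ (substP-cong hs ht A) (substP-cong hs ht B)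
  substP-cong hs ht (A & B)     = cong₂ _&_ (substP-cong hs ht A) (substP-cong hs ht B)
  substP-cong hs ht ⊤'          = refl
  substP-cong hs ht (A ⊕ B)     = cong₂ _⊕_ (substP-cong hs ht A) (substP-cong hs ht B)
  substP-cong hs ht 𝟎           = refl
  substP-cong hs ht (! A)       = cong !_ (substP-cong hs ht A)
  substP-cong hs ht (∀t A)      = cong ∀t (substP-cong (liftT-cong hs) ht A)
  substP-cong hs ht (∃t A)      = cong ∃t (substP-cong (liftT-cong hs) ht A)
  substP-cong hs ht (A at w)    = cong₂ _at_ (substP-cong hs ht A) (substW-cong ht w)
  substP-cong hs ht (↓ A)       = cong ↓_ (substP-cong hs (liftW-cong ht) A)
  substP-cong hs ht (∀w A)      = cong ∀w (substP-cong hs (liftW-cong ht) A)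
  substP-cong hs ht (∃w A)      = cong ∃w (substP-cong hs (liftW-cong ht) A)

  substP-comp : ∀ {m m' m'' k k' k''} (σ : Fin m → Term m') (τ : Fin k → World k')
                  (σ' : Fin m' → Term m'') (τ' : Fin k' → World k'') A
              → substP σ' τ' (substP σ τ A) ≡ substP (λ i → substT σ' (σ i)) (λ i → substW τ' (τ i)) A
  substP-comp σ τ σ' τ' (atom p ts) = cong (atom p) (substTs-comp σ σ' ts)
  substP-comp σ τ σ' τ' (A ⊗ B)     = cong₂ _⊗_ (substP-comp σ τ σ' τ' A) (substP-comp σ τ σ' τ' B)
  substP-comp σ τ σ' τ' 𝟏           = refl
  substP-comp σ τ σ' τ' (A ⊸ B)     = cong₂ _⊸_ (substP-comp σ τ σ' τ' A) (substP-comp σ τ σ' τ' B)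
  substP-comp σ τ σ' τ' (A & B)     = cong₂ _&_ (substP-comp σ τ σ' τ' A) (substP-comp σ τ σ' τ' B)
  substP-comp σ τ σ' τ' ⊤'          = refl
  substP-comp σ τ σ' τ' (A ⊕ B)     = cong₂ _⊕_ (substP-comp σ τ σ' τ' A) (substP-comp σ τ σ' τ' B)
  substP-comp σ τ σ' τ' 𝟎           = refl
  substP-comp σ τ σ' τ' (! A)       = cong !_ (substP-comp σ τ σ' τ' A)
  substP-comp σ τ σ' τ' (∀t A)      =
    cong ∀t (trans (substP-comp (liftT σ) τ (liftT σ') τ' A) (substP-cong (liftT-comp σ σ') (λ _ → refl) A))
  substP-comp σ τ σ' τ' (∃t A)      =
    cong ∃t (trans (substP-comp (liftT σ) τ (liftT σ') τ' A) (substP-cong (liftT-comp σ σ') (λ _ → refl) A))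
  substP-comp σ τ σ' τ' (A at w)    = cong₂ _at_ (substP-comp σ τ σ' τ' A) (substW-comp τ τ' w)
  substP-comp σ τ σ' τ' (↓ A)       =
    cong ↓_ (trans (substP-comp σ (liftW τ) σ' (liftW τ') A) (substP-cong (λ _ → refl) (liftW-comp τ τ') A))
  substP-comp σ τ σ' τ' (∀w A)      =
    cong ∀w (trans (substP-comp σ (liftW τ) σ' (liftW τ') A) (substP-cong (λ _ → refl) (liftW-comp τ τ') A))
  substP-comp σ τ σ' τ' (∃w A)      =
    cong ∃w (trans (substP-comp σ (liftW τ) σ' (liftW τ') A) (substP-cong (λ _ → refl) (liftW-comp τ τ') A))

  substP-id : ∀ {m k} (A : Prop m k) → substP var wvar A ≡ A
  substP-id (atom p ts) = cong (atom p) (substTs-id ts)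
  substP-id (A ⊗ B)     = cong₂ _⊗_ (substP-id A) (substP-id B)
  substP-id 𝟏           = refl
  substP-id (A ⊸ B)     = cong₂ _⊸_ (substP-id A) (substP-id B)
  substP-id (A & B)     = cong₂ _&_ (substP-id A) (substP-id B)
  substP-id ⊤'          = refl
  substP-id (A ⊕ B)     = cong₂ _⊕_ (substP-id A) (substP-id B)
  substP-id 𝟎           = refl
  substP-id (! A)       = cong !_ (substP-id A)
  substP-id (∀t A)      = cong ∀t (trans (substP-cong liftT-id (λ _ → refl) A) (substP-id A))
  substP-id (∃t A)      = cong ∃t (trans (substP-cong liftT-id (λ _ → refl) A) (substP-id A))
  substP-id (A at w)    = cong₂ _at_ (substP-id A) (substW-id w)
  substP-id (↓ A)       = cong ↓_ (trans (substP-cong (λ _ → refl) liftW-id A) (substP-id A))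
  substP-id (∀w A)      = cong ∀w (trans (substP-cong (λ _ → refl) liftW-id A) (substP-id A))
  substP-id (∃w A)      = cong ∃w (trans (substP-cong (λ _ → refl) liftW-id A) (substP-id A))

  size : ∀ {m k} → Prop m k → ℕ
  size (atom p ts) = 0
  size (A ⊗ B)     = suc (size A + size B)
  size 𝟏           = 0
  size (A ⊸ B)     = suc (size A + size B)
  size (A & B)     = suc (size A + size B)
  size ⊤'          = 0
  size (A ⊕ B)     = suc (size A + size B)
  size 𝟎           = 0
  size (! A)       = suc (size A)
  size (∀t A)      = suc (size A)
  size (∃t A)      = suc (size A)
  size (A at w)    = suc (size A)
  size (↓ A)       = suc (size A)
  size (∀w A)      = suc (size A)
  size (∃w A)      = suc (size A)

  -- substitution never changes the size, so instantiating a quantifier shrinks it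
  size-substP : ∀ {m m' k k'} (σ : Fin m → Term m') (τ : Fin k → World k') A
              → size (substP σ τ A) ≡ size A
  size-substP σ τ (atom p ts) = refl
  size-substP σ τ (A ⊗ B)     = cong₂ (λ x y → suc (x + y)) (size-substP σ τ A) (size-substP σ τ B)
  size-substP σ τ 𝟏           = refl
  size-substP σ τ (A ⊸ B)     = cong₂ (λ x y → suc (x + y)) (size-substP σ τ A) (size-substP σ τ B)
  size-substP σ τ (A & B)     = cong₂ (λ x y → suc (x + y)) (size-substP σ τ A) (size-substP σ τ B)
  size-substP σ τ ⊤'          = refl
  size-substP σ τ (A ⊕ B)     = cong₂ (λ x y → suc (x + y)) (size-substP σ τ A) (size-substP σ τ B)
  size-substP σ τ 𝟎           = refl
  size-substP σ τ (! A)       = cong suc (size-substP σ τ A)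
  size-substP σ τ (∀t A)      = cong suc (size-substP (liftT σ) τ A)
  size-substP σ τ (∃t A)      = cong suc (size-substP (liftT σ) τ A)
  size-substP σ τ (A at w)    = cong suc (size-substP σ τ A)
  size-substP σ τ (↓ A)       = cong suc (size-substP σ (liftW τ) A)
  size-substP σ τ (∀w A)      = cong suc (size-substP σ (liftW τ) A)
  size-substP σ τ (∃w A)      = cong suc (size-substP σ (liftW τ) A)

  record Sub (m k m' k' : ℕ) : Set c where
    constructor ⟨_,_⟩
    field
      σ : Fin m → Term m'
      τ : Fin k → World k'
  open Sub public

  subP : ∀ {m k m' k'} → Sub m k m' k' → Prop m k → Prop m' k'
  subP θ = substP (σ θ) (τ θ)

  subW : ∀ {m k m' k'} → Sub m k m' k' → World k → World k'
  subW θ = substW (τ θ)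

  subJ : ∀ {m k m' k'} → Sub m k m' k' → Judg m k → Judg m' k'
  subJ θ (A ＠ u) = subP θ A ＠ subW θ u

  infixr 9 _⊙_
  _⊙_ : ∀ {m k m' k' m'' k''} → Sub m' k' m'' k'' → Sub m k m' k' → Sub m k m'' k''
  θ' ⊙ θ = ⟨ (λ i → substT (σ θ') (σ θ i)) , (λ i → substW (τ θ') (τ θ i)) ⟩

  idS : ∀ {m k} → Sub m k m k
  idS = ⟨ var , wvar ⟩

  wkt : ∀ {m k} → Sub m k (suc m) k
  wkt = ⟨ (λ i → var (suc i)) , wvar ⟩

  wkw : ∀ {m k} → Sub m k m (suc k)
  wkw = ⟨ var , (λ i → wvar (suc i)) ⟩

  wkW : ∀ {k} → World k → World (suc k)
  wkW = substW (λ i → wvar (suc i))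

  ↑t : ∀ {m k m' k'} → Sub m k m' k' → Sub (suc m) k (suc m') k'
  ↑t θ = ⟨ liftT (σ θ) , τ θ ⟩

  ↑w : ∀ {m k m' k'} → Sub m k m' k' → Sub m (suc k) m' (suc k')
  ↑w θ = ⟨ σ θ , liftW (τ θ) ⟩

  inst-t : ∀ {m k} → Term m → Sub (suc m) k m k
  inst-t t = ⟨ sub0T t , wvar ⟩

  inst-w : ∀ {m k} → World k → Sub m (suc k) m k
  inst-w w = ⟨ var , sub0W w ⟩

  subJ-cong : ∀ {m k m' k'} (θ θ' : Sub m k m' k') → (∀ i → σ θ i ≡ σ θ' i) → (∀ i → τ θ i ≡ τ θ' i)
            → ∀ J → subJ θ J ≡ subJ θ' J
  subJ-cong θ θ' hs ht (A ＠ u) = cong₂ _＠_ (substP-cong hs ht A) (substW-cong ht u)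

  subJ-comp : ∀ {m k m' k' m'' k''} (θ' : Sub m' k' m'' k'') (θ : Sub m k m' k') J
            → subJ θ' (subJ θ J) ≡ subJ (θ' ⊙ θ) J
  subJ-comp θ' θ (A ＠ u) = cong₂ _＠_ (substP-comp (σ θ) (τ θ) (σ θ') (τ θ') A) (substW-comp (τ θ) (τ θ') u)

  subJ-id : ∀ {m k} (J : Judg m k) → subJ idS J ≡ J
  subJ-id (A ＠ u) = cong₂ _＠_ (substP-id A) (substW-id u)

  subJ-square : ∀ {m k m₁ k₁ m₂ k₂ m' k'} (θa : Sub m₁ k₁ m' k') (θb : Sub m k m₁ k₁)
                  (θc : Sub m₂ k₂ m' k') (θd : Sub m k m₂ k₂)
              → (∀ i → σ (θa ⊙ θb) i ≡ σ (θc ⊙ θd) i) → (∀ i → τ (θa ⊙ θb) i ≡ τ (θc ⊙ θd) i)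
              → ∀ J → subJ θa (subJ θb J) ≡ subJ θc (subJ θd J)
  subJ-square θa θb θc θd hs ht J =
    trans (subJ-comp θa θb J) (trans (subJ-cong _ _ hs ht J) (sym (subJ-comp θc θd J)))

  wkJt-is-sub : ∀ {m k} (J : Judg m k) → wkJt J ≡ subJ wkt J
  wkJt-is-sub (A ＠ u) = cong (_ ＠_) (sym (substW-id u))

  wkJw-is-sub : ∀ {m k} (J : Judg m k) → wkJw J ≡ subJ wkw J
  wkJw-is-sub (A ＠ u) = refl

  ↑t-wkJt : ∀ {m k m' k'} (θ : Sub m k m' k') J → subJ (↑t θ) (wkJt J) ≡ wkJt (subJ θ J)
  ↑t-wkJt θ J =
    trans (cong (subJ (↑t θ)) (wkJt-is-sub J))
      (trans (subJ-square (↑t θ) wkt wkt θ (λ i → refl) (λ i → sym (substW-id (τ θ i))) J)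
        (sym (wkJt-is-sub (subJ θ J))))

  ↑w-wkJw : ∀ {m k m' k'} (θ : Sub m k m' k') J → subJ (↑w θ) (wkJw J) ≡ wkJw (subJ θ J)
  ↑w-wkJw θ (A ＠ u) = subJ-square (↑w θ) wkw wkw θ (λ i → sym (substT-id (σ θ i))) (λ i → refl) (A ＠ u)

  ↑w-wkW : ∀ {m k m' k'} (θ : Sub m k m' k') (w : World k) → subW (↑w θ) (wkW w) ≡ wkW (subW θ w)
  ↑w-wkW θ w = trans (substW-comp _ (liftW (τ θ)) w) (sym (substW-comp (τ θ) _ w))

  inst-t-wkJt : ∀ {m k} (t : Term m) (J : Judg m k) → subJ (inst-t t) (wkJt J) ≡ J
  inst-t-wkJt t J =
    trans (cong (subJ (inst-t t)) (wkJt-is-sub J))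
      (trans (subJ-comp (inst-t t) wkt J) (trans (subJ-cong _ idS (λ i → refl) (λ i → refl) J) (subJ-id J)))

  inst-w-wkJw : ∀ {m k} (w : World k) (J : Judg m k) → subJ (inst-w w) (wkJw J) ≡ J
  inst-w-wkJw w (A ＠ u) =
    trans (subJ-comp (inst-w w) wkw (A ＠ u)) (trans (subJ-cong _ idS (λ i → refl) (λ i → refl) (A ＠ u)) (subJ-id (A ＠ u)))

  inst-w-wkW : ∀ {k} (s w : World k) → substW (sub0W s) (wkW w) ≡ w
  inst-w-wkW s w = trans (substW-comp _ (sub0W s) w) (substW-id w)

  wkt-⊙ : ∀ {m k m' k'} (θ : Sub m k m' k') J → subJ (wkt ⊙ θ) J ≡ wkJt (subJ θ J)
  wkt-⊙ θ J = trans (sym (subJ-comp wkt θ J)) (sym (wkJt-is-sub (subJ θ J)))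

  wkw-⊙ : ∀ {m k m' k'} (θ : Sub m k m' k') J → subJ (wkw ⊙ θ) J ≡ wkJw (subJ θ J)
  wkw-⊙ θ (A ＠ u) = sym (subJ-comp wkw θ (A ＠ u))

  subP-inst-t : ∀ {m k m' k'} (θ : Sub m k m' k') (A : Prop (suc m) k) (t : Term m)
              → subP θ (A [ t /x]) ≡ (subP (↑t θ) A) [ substT (σ θ) t /x]
  subP-inst-t θ A t =
    trans (substP-comp (sub0T t) wvar (σ θ) (τ θ) A)
      (trans (substP-cong hs ht A) (sym (substP-comp (liftT (σ θ)) (τ θ) (sub0T (substT (σ θ) t)) wvar A)))
    where
      hs : ∀ i → substT (σ θ) (sub0T t i) ≡ substT (sub0T (substT (σ θ) t)) (liftT (σ θ) i)
      hs zero    = refl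
      hs (suc i) = sym (trans (substT-comp (λ j → var (suc j)) (sub0T (substT (σ θ) t)) (σ θ i)) (substT-id (σ θ i)))
      ht : ∀ i → substW (τ θ) (wvar i) ≡ substW wvar (τ θ i)
      ht i = sym (substW-id (τ θ i))

  subP-inst-w : ∀ {m k m' k'} (θ : Sub m k m' k') (A : Prop m (suc k)) (w : World k)
              → subP θ (A [ w /u]) ≡ (subP (↑w θ) A) [ subW θ w /u]
  subP-inst-w θ A w =
    trans (substP-comp var (sub0W w) (σ θ) (τ θ) A)
      (trans (substP-cong hs ht A) (sym (substP-comp (σ θ) (liftW (τ θ)) var (sub0W (subW θ w)) A)))
    where
      hs : ∀ i → substT (σ θ) (var i) ≡ substT var (σ θ i)
      hs i = sym (substT-id (σ θ i))
      ht : ∀ i → substW (τ θ) (sub0W w i) ≡ substW (sub0W (subW θ w)) (liftW (τ θ) i)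
      ht zero    = refl
      ht (suc i) = sym (inst-w-wkW (subW θ w) (τ θ i))

  size-subP : ∀ {m k m' k' n} (θ : Sub m k m' k') (A : Prop m k) → size A ≤ n → size (subP θ A) ≤ n
  size-subP {n = n} θ A = subst (_≤ n) (sym (size-substP (σ θ) (τ θ) A))

-- A single traversal covers both plain substitution
-- (hypotheses of Γ mapped to hypotheses) and the unrestricted cut (hypotheses of Γ
-- mapped to cut-able derivations), by abstracting over what a usable hypothesis is.
module Derivations {c ℓ : Level} (𝒲 : Monoid c ℓ) (Sg : Signature) where
  open HyLL 𝒲 Sg
  open Syntax 𝒲 Sg

  castR : ∀ {m k} {Γ Δ : List (Judg m k)} {J J'} → J ≡ J' → Γ ⨾ Δ ⟹ J → Γ ⨾ Δ ⟹ J'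
  castR refl d = d

  castL : ∀ {m k} {Γ Δ Δ' : List (Judg m k)} {J} → Δ ≡ Δ' → Γ ⨾ Δ ⟹ J → Γ ⨾ Δ' ⟹ J
  castL refl d = d

  map-subJ-id : ∀ {m k} (Δ : List (Judg m k)) → map (subJ idS) Δ ≡ Δ
  map-subJ-id Δ = trans (map-cong subJ-id Δ) (map-id Δ)

  record HypStructure : Set (Level.suc c) where
    field
      Hyp    : ∀ {m k} → List (Judg m k) → Judg m k → Set c
      hyp-wkt : ∀ {m k} {Γ : List (Judg m k)} {K} → Hyp Γ K → Hyp (map wkJt Γ) (wkJt K)
      hyp-wkw : ∀ {m k} {Γ : List (Judg m k)} {K} → Hyp Γ K → Hyp (map wkJw Γ) (wkJw K)
      hyp-∷  : ∀ {m k} {Γ : List (Judg m k)} {K K'} → Hyp Γ K → Hyp (K' ∷ Γ) K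
      hyp-hd : ∀ {m k} {Γ : List (Judg m k)} {K} → Hyp (K ∷ Γ) K
      use    : ∀ {m k} {Γ Δ : List (Judg m k)} {K C w} → Hyp Γ K → Γ ⨾ K ∷ Δ ⟹ C ＠ w → Γ ⨾ Δ ⟹ C ＠ w

  module Substitution (H : HypStructure) where
    open HypStructure H

    Maps : ∀ {m k m' k'} → Sub m k m' k' → List (Judg m k) → List (Judg m' k') → Set c
    Maps θ Γ₀ Γ = ∀ {J} → J ∈ Γ₀ → Hyp Γ (subJ θ J)

    Maps-↑t : ∀ {m k m' k'} (θ : Sub m k m' k') {Γ₀ Γ} → Maps θ Γ₀ Γ → Maps (↑t θ) (map wkJt Γ₀) (map wkJt Γ)
    Maps-↑t θ h J∈ with ∈-map⁻ wkJt J∈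
    ... | J₀ , J₀∈ , refl = subst (Hyp _) (sym (↑t-wkJt θ J₀)) (hyp-wkt (h J₀∈))

    Maps-↑w : ∀ {m k m' k'} (θ : Sub m k m' k') {Γ₀ Γ} → Maps θ Γ₀ Γ → Maps (↑w θ) (map wkJw Γ₀) (map wkJw Γ)
    Maps-↑w θ h J∈ with ∈-map⁻ wkJw J∈
    ... | J₀ , J₀∈ , refl = subst (Hyp _) (sym (↑w-wkJw θ J₀)) (hyp-wkw (h J₀∈))

    Maps-∷ : ∀ {m k m' k'} (θ : Sub m k m' k') {Γ₀ Γ} K → Maps θ Γ₀ Γ → Maps θ (K ∷ Γ₀) (subJ θ K ∷ Γ)
    Maps-∷ θ K h (here refl) = hyp-hd
    Maps-∷ θ K h (there J∈)  = hyp-∷ (h J∈)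

    substitute : ∀ {m k m' k'} (θ : Sub m k m' k') {Γ₀ Γ Δ C w}
               → Maps θ Γ₀ Γ → Γ₀ ⨾ Δ ⟹ C ＠ w → Γ ⨾ map (subJ θ) Δ ⟹ subJ θ (C ＠ w)
    substitute θ h (exch q E)  = exch (map⁺ (subJ θ) q) (substitute θ h E)
    substitute θ h init        = init
    substitute θ h (copy x E)  = use (h x) (substitute θ h E)
    substitute θ h (⊗R {Δ = Δ} {Δ' = Δ'} E₁ E₂) =
      castL (sym (map-++ (subJ θ) Δ Δ')) (⊗R (substitute θ h E₁) (substitute θ h E₂))
    substitute θ h (⊗L E)      = ⊗L (substitute θ h E)
    substitute θ h 𝟏R          = 𝟏R
    substitute θ h (𝟏L E)      = 𝟏L (substitute θ h E)
    substitute θ h (⊸R E)      = ⊸R (substitute θ h E)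
    substitute θ h (⊸L {Δ = Δ} {Δ' = Δ'} E₁ E₂) =
      castL (cong (_ ∷_) (sym (map-++ (subJ θ) Δ Δ'))) (⊸L (substitute θ h E₁) (substitute θ h E₂))
    substitute θ h ⊤R          = ⊤R
    substitute θ h (&R E₁ E₂)  = &R (substitute θ h E₁) (substitute θ h E₂)
    substitute θ h (&L₁ E)     = &L₁ (substitute θ h E)
    substitute θ h (&L₂ E)     = &L₂ (substitute θ h E)
    substitute θ h (⊕R₁ E)     = ⊕R₁ (substitute θ h E)
    substitute θ h (⊕R₂ E)     = ⊕R₂ (substitute θ h E)
    substitute θ h (⊕L E₁ E₂)  = ⊕L (substitute θ h E₁) (substitute θ h E₂)
    substitute θ h 𝟎L          = 𝟎L
    substitute θ h (∀tR {Δ = Δ} E) =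
      ∀tR (castL (map-commute (↑t-wkJt θ) Δ) (substitute (↑t θ) (Maps-↑t θ h) E))
    substitute θ h (∀tL {A = A} t E) =
      ∀tL (substT (σ θ) t) (castL (cong (λ X → X ＠ _ ∷ _) (subP-inst-t θ A t)) (substitute θ h E))
    substitute θ h (∃tR {A = A} t E) =
      ∃tR (substT (σ θ) t) (castR (cong (_＠ _) (subP-inst-t θ A t)) (substitute θ h E))
    substitute θ h (∃tL {Δ = Δ} {C = C} {w = w} E) =
      ∃tL (castR (↑t-wkJt θ (C ＠ w)) (castL (cong (_ ∷_) (map-commute (↑t-wkJt θ) Δ))
        (substitute (↑t θ) (Maps-↑t θ h) E)))
    substitute θ h (∀wR {Δ = Δ} {w = w} E) =
      ∀wR (castR (cong (_ ＠_) (↑w-wkW θ w)) (castL (map-commute (↑w-wkJw θ) Δ)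
        (substitute (↑w θ) (Maps-↑w θ h) E)))
    substitute θ h (∀wL {A = A} v E) =
      ∀wL (subW θ v) (castL (cong (λ X → X ＠ _ ∷ _) (subP-inst-w θ A v)) (substitute θ h E))
    substitute θ h (∃wR {A = A} v E) =
      ∃wR (subW θ v) (castR (cong (_＠ _) (subP-inst-w θ A v)) (substitute θ h E))
    substitute θ h (∃wL {Δ = Δ} {u = u} {C = C} {w = w} E) =
      ∃wL (castR (↑w-wkJw θ (C ＠ w)) (castL (cong₂ (λ a b → _ ＠ a ∷ b) (↑w-wkW θ u) (map-commute (↑w-wkJw θ) Δ))
        (substitute (↑w θ) (Maps-↑w θ h) E)))
    substitute θ h (!R E)      = !R (substitute θ h E)
    substitute θ h (!L {A = A} {u = u} E) = !L (substitute θ (Maps-∷ θ (A ＠ u) h) E)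
    substitute θ h (atR E)     = atR (substitute θ h E)
    substitute θ h (atL E)     = atL (substitute θ h E)
    substitute θ h (↓R {A = A} {w = w} E) =
      ↓R (castR (cong (_＠ _) (subP-inst-w θ A w)) (substitute θ h E))
    substitute θ h (↓L {A = A} {v = v} E) =
      ↓L (castL (cong (λ X → X ＠ _ ∷ _) (subP-inst-w θ A v)) (substitute θ h E))

  copyJ : ∀ {m k} {Γ Δ : List (Judg m k)} {K J} → K ∈ Γ → Γ ⨾ K ∷ Δ ⟹ J → Γ ⨾ Δ ⟹ J
  copyJ {K = A ＠ u} x d = copy x d

  membership : HypStructure
  membership = record
    { Hyp = λ Γ K → K ∈ Γ ; hyp-wkt = ∈-map⁺ wkJt ; hyp-wkw = ∈-map⁺ wkJw
    ; hyp-∷ = there ; hyp-hd = here refl ; use = copyJ }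

  open Substitution membership public
    using () renaming (Maps to Incl; Maps-↑t to incl-↑t; Maps-↑w to incl-↑w; Maps-∷ to incl-∷)

  subD : ∀ {m k m' k'} (θ : Sub m k m' k') {Γ₀ Γ Δ C w}
       → Incl θ Γ₀ Γ → Γ₀ ⨾ Δ ⟹ C ＠ w → Γ ⨾ map (subJ θ) Δ ⟹ subJ θ (C ＠ w)
  subD = Substitution.substitute membership

  incl-id : ∀ {m k} {Γ : List (Judg m k)} → Incl idS Γ Γ
  incl-id {Γ = Γ} {J} J∈ = subst (_∈ Γ) (sym (subJ-id J)) J∈

  incl-wkt : ∀ {m k m' k'} (θ : Sub m k m' k') {Γ₀ Γ} → Incl θ Γ₀ Γ → Incl (wkt ⊙ θ) Γ₀ (map wkJt Γ)
  incl-wkt θ g {J} J∈ = subst (_∈ _) (sym (wkt-⊙ θ J)) (∈-map⁺ wkJt (g J∈))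

  incl-wkw : ∀ {m k m' k'} (θ : Sub m k m' k') {Γ₀ Γ} → Incl θ Γ₀ Γ → Incl (wkw ⊙ θ) Γ₀ (map wkJw Γ)
  incl-wkw θ g {J} J∈ = subst (_∈ _) (sym (wkw-⊙ θ J)) (∈-map⁺ wkJw (g J∈))

  incl-inst-t : ∀ {m k} (t : Term m) {Γ : List (Judg m k)} → Incl (inst-t t) (map wkJt Γ) Γ
  incl-inst-t t J∈ with ∈-map⁻ wkJt J∈
  ... | J₀ , J₀∈ , refl = subst (_∈ _) (sym (inst-t-wkJt t J₀)) J₀∈

  incl-inst-w : ∀ {m k} (w : World k) {Γ : List (Judg m k)} → Incl (inst-w w) (map wkJw Γ) Γ
  incl-inst-w w J∈ with ∈-map⁻ wkJw J∈
  ... | J₀ , J₀∈ , refl = subst (_∈ _) (sym (inst-w-wkJw w J₀)) J₀∈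

  weaken-t : ∀ {m k} {Γ Δ : List (Judg m k)} {J} → Γ ⨾ Δ ⟹ J → map wkJt Γ ⨾ map wkJt Δ ⟹ wkJt J
  weaken-t {Δ = Δ} {J = C ＠ w} d =
    castR (sym (wkJt-is-sub (C ＠ w))) (castL (map-cong (λ J → sym (wkJt-is-sub J)) Δ) (subD wkt incl d))
    where
      incl : ∀ {J} → J ∈ _ → subJ wkt J ∈ _
      incl {J} J∈ = subst (_∈ _) (wkJt-is-sub J) (∈-map⁺ wkJt J∈)

  weaken-w : ∀ {m k} {Γ Δ : List (Judg m k)} {J} → Γ ⨾ Δ ⟹ J → map wkJw Γ ⨾ map wkJw Δ ⟹ wkJw J
  weaken-w {Δ = Δ} {J = C ＠ w} d = castL (map-cong (λ J → sym (wkJw-is-sub J)) Δ) (subD wkw incl d)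
    where
      incl : ∀ {J} → J ∈ _ → subJ wkw J ∈ _
      incl {J} J∈ = subst (_∈ _) (wkJw-is-sub J) (∈-map⁺ wkJw J∈)

  weaken-∷ : ∀ {m k} {Γ Δ : List (Judg m k)} {K J} → Γ ⨾ Δ ⟹ J → (K ∷ Γ) ⨾ Δ ⟹ J
  weaken-∷ {Δ = Δ} {J = C ＠ w} d =
    castR (subJ-id (C ＠ w)) (castL (map-subJ-id Δ) (subD idS (λ J∈ → there (incl-id J∈)) d))

module CutElimination {c ℓ : Level} (𝒲 : Monoid c ℓ) (Sg : Signature) where
  open HyLL 𝒲 Sg
  open Syntax 𝒲 Sg
  open Derivations 𝒲 Sg
  open Permutation

  CutUpTo : ℕ → Set c
  CutUpTo n = ∀ {m k} {Γ Δ₁ Δ₂ Rest : List (Judg m k)} {A u C w} → size A ≤ n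
            → Γ ⨾ Δ₁ ⟹ A ＠ u → Γ ⨾ Δ₂ ⟹ C ＠ w → Δ₂ ↭ A ＠ u ∷ Rest → Γ ⨾ Δ₁ ++ Rest ⟹ C ＠ w

  -- "Principal Γ Rest C w K": a derivation of Γ ⨾ K , Rest ⟹ C ＠ w ending in the left
  -- rule for K, given by that rule's premises (linear context up to permutation).
  data Principal {m k : ℕ} (Γ Rest : List (Judg m k)) (C : Prop m k) (w : World k) : Judg m k → Set c where
    p⊗  : ∀ {X Y v Δ} → Γ ⨾ X ＠ v ∷ Y ＠ v ∷ Δ ⟹ C ＠ w → Δ ↭ Rest → Principal Γ Rest C w ((X ⊗ Y) ＠ v)
    p𝟏  : ∀ {v Δ} → Γ ⨾ Δ ⟹ C ＠ w → Δ ↭ Rest → Principal Γ Rest C w (𝟏 ＠ v)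
    p⊸  : ∀ {X Y v Δa Δb} → Γ ⨾ Δa ⟹ X ＠ v → Γ ⨾ Y ＠ v ∷ Δb ⟹ C ＠ w → Δa ++ Δb ↭ Rest
        → Principal Γ Rest C w ((X ⊸ Y) ＠ v)
    p&₁ : ∀ {X Y v Δ} → Γ ⨾ X ＠ v ∷ Δ ⟹ C ＠ w → Δ ↭ Rest → Principal Γ Rest C w ((X & Y) ＠ v)
    p&₂ : ∀ {X Y v Δ} → Γ ⨾ Y ＠ v ∷ Δ ⟹ C ＠ w → Δ ↭ Rest → Principal Γ Rest C w ((X & Y) ＠ v)
    p⊕  : ∀ {X Y v Δ} → Γ ⨾ X ＠ v ∷ Δ ⟹ C ＠ w → Γ ⨾ Y ＠ v ∷ Δ ⟹ C ＠ w → Δ ↭ Rest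
        → Principal Γ Rest C w ((X ⊕ Y) ＠ v)
    p𝟎  : ∀ {v} → Principal Γ Rest C w (𝟎 ＠ v)
    p∀t : ∀ {X v Δ} (s : Term m) → Γ ⨾ X [ s /x] ＠ v ∷ Δ ⟹ C ＠ w → Δ ↭ Rest → Principal Γ Rest C w (∀t X ＠ v)
    p∃t : ∀ {X v Δ} → map wkJt Γ ⨾ X ＠ v ∷ map wkJt Δ ⟹ wkJt (C ＠ w) → Δ ↭ Rest
        → Principal Γ Rest C w (∃t X ＠ v)
    p∀w : ∀ {X v Δ} (s : World k) → Γ ⨾ X [ s /u] ＠ v ∷ Δ ⟹ C ＠ w → Δ ↭ Rest → Principal Γ Rest C w (∀w X ＠ v)
    p∃w : ∀ {X v Δ} → map wkJw Γ ⨾ X ＠ wkW v ∷ map wkJw Δ ⟹ wkJw (C ＠ w) → Δ ↭ Rest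
        → Principal Γ Rest C w (∃w X ＠ v)
    p!  : ∀ {X v Δ} → (X ＠ v ∷ Γ) ⨾ Δ ⟹ C ＠ w → Δ ↭ Rest → Principal Γ Rest C w ((! X) ＠ v)
    pat : ∀ {X v v' Δ} → Γ ⨾ X ＠ v' ∷ Δ ⟹ C ＠ w → Δ ↭ Rest → Principal Γ Rest C w ((X at v') ＠ v)
    p↓  : ∀ {X v Δ} → Γ ⨾ X [ v /u] ＠ v ∷ Δ ⟹ C ＠ w → Δ ↭ Rest → Principal Γ Rest C w ((↓ X) ＠ v)

  reduce-𝟏 : ∀ {m k} {Γ Rest : List (Judg m k)} {C w v} → Principal Γ Rest C w (𝟏 ＠ v) → Γ ⨾ Rest ⟹ C ＠ w
  reduce-𝟏 (p𝟏 E q) = exch q E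

  module _ {n m k} {Γ Rest : List (Judg m k)} {C : Prop m k} {w : World k} (cut : CutUpTo n) where

    reduce-⊗ : ∀ {A B v Δa Δb} → size (A ⊗ B) ≤ suc n → Γ ⨾ Δa ⟹ A ＠ v → Γ ⨾ Δb ⟹ B ＠ v
             → Principal Γ Rest C w ((A ⊗ B) ＠ v) → Γ ⨾ (Δa ++ Δb) ++ Rest ⟹ C ＠ w
    reduce-⊗ {A} {Δa = Δa} {Δb} (s≤s sz) D₁ D₂ (p⊗ {Δ = Δ} E q) =
      exch (↭-trans (shifts Δb Δa) (↭-trans (++⁺ˡ Δa (++⁺ˡ Δb q)) (↭-sym (↭-assoc Δa Δb Rest))))
        (cut (m+n≤o⇒n≤o (size A) sz) D₂ (cut (m+n≤o⇒m≤o (size A) sz) D₁ E ↭-refl) (shift _ Δa Δ))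

    reduce-⊸ : ∀ {A B v Δ} → size (A ⊸ B) ≤ suc n → Γ ⨾ A ＠ v ∷ Δ ⟹ B ＠ v
             → Principal Γ Rest C w ((A ⊸ B) ＠ v) → Γ ⨾ Δ ++ Rest ⟹ C ＠ w
    reduce-⊸ {A} {Δ = Δ} (s≤s sz) D (p⊸ {Δa = Δa} {Δb} E₁ E₂ q) =
      exch (↭-trans (↭-assoc Δa Δ Δb) (↭-trans (shifts Δa Δ) (++⁺ˡ Δ q)))
        (cut (m+n≤o⇒n≤o (size A) sz) (cut (m+n≤o⇒m≤o (size A) sz) E₁ D ↭-refl) E₂ ↭-refl)

    reduce-& : ∀ {A B v Δ} → size (A & B) ≤ suc n → Γ ⨾ Δ ⟹ A ＠ v → Γ ⨾ Δ ⟹ B ＠ v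
             → Principal Γ Rest C w ((A & B) ＠ v) → Γ ⨾ Δ ++ Rest ⟹ C ＠ w
    reduce-& {A} {Δ = Δ} (s≤s sz) D₁ D₂ (p&₁ E q) = exch (++⁺ˡ Δ q) (cut (m+n≤o⇒m≤o (size A) sz) D₁ E ↭-refl)
    reduce-& {A} {Δ = Δ} (s≤s sz) D₁ D₂ (p&₂ E q) = exch (++⁺ˡ Δ q) (cut (m+n≤o⇒n≤o (size A) sz) D₂ E ↭-refl)

    reduce-⊕₁ : ∀ {A B v Δ} → size (A ⊕ B) ≤ suc n → Γ ⨾ Δ ⟹ A ＠ v
              → Principal Γ Rest C w ((A ⊕ B) ＠ v) → Γ ⨾ Δ ++ Rest ⟹ C ＠ w
    reduce-⊕₁ {A} {Δ = Δ} (s≤s sz) D (p⊕ E₁ E₂ q) = exch (++⁺ˡ Δ q) (cut (m+n≤o⇒m≤o (size A) sz) D E₁ ↭-refl)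

    reduce-⊕₂ : ∀ {A B v Δ} → size (A ⊕ B) ≤ suc n → Γ ⨾ Δ ⟹ B ＠ v
              → Principal Γ Rest C w ((A ⊕ B) ＠ v) → Γ ⨾ Δ ++ Rest ⟹ C ＠ w
    reduce-⊕₂ {A} {Δ = Δ} (s≤s sz) D (p⊕ E₁ E₂ q) = exch (++⁺ˡ Δ q) (cut (m+n≤o⇒n≤o (size A) sz) D E₂ ↭-refl)

    -- ∀x.A against ∀L with witness s: instantiate the eigenvariable of the left premise by s
    reduce-∀t : ∀ {A v Δ} → size (∀t A) ≤ suc n → map wkJt Γ ⨾ map wkJt Δ ⟹ A ＠ v
              → Principal Γ Rest C w (∀t A ＠ v) → Γ ⨾ Δ ++ Rest ⟹ C ＠ w
    reduce-∀t {A} {v} {Δ} (s≤s sz) D (p∀t s E q) =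
      exch (++⁺ˡ Δ q) (cut (size-subP (inst-t s) A sz) D[s] E ↭-refl)
      where
        D[s] : Γ ⨾ Δ ⟹ A [ s /x] ＠ v
        D[s] = castR (cong (_ ＠_) (substW-id _)) (castL (map-inverse (inst-t-wkJt s) Δ)
                 (subD (inst-t s) (incl-inst-t s) D))

    -- ∃x.A with witness t against ∃L: instantiate the eigenvariable of the right premise by t
    reduce-∃t : ∀ {A v Δ} {t : Term m} → size (∃t A) ≤ suc n → Γ ⨾ Δ ⟹ A [ t /x] ＠ v
              → Principal Γ Rest C w (∃t A ＠ v) → Γ ⨾ Δ ++ Rest ⟹ C ＠ w
    reduce-∃t {A} {v} {Δ} {t} (s≤s sz) D (p∃t {Δ = Δ'} E q) =
      exch (++⁺ˡ Δ q) (cut (size-subP (inst-t t) A sz) D E[t] ↭-refl)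
      where
        E[t] : Γ ⨾ A [ t /x] ＠ v ∷ Δ' ⟹ C ＠ w
        E[t] = castR (inst-t-wkJt t (C ＠ w))
                 (castL (cong₂ (λ a b → _ ＠ a ∷ b) (substW-id _) (map-inverse (inst-t-wkJt t) Δ'))
                   (subD (inst-t t) (incl-inst-t t) E))

    reduce-∀w : ∀ {A v Δ} → size (∀w A) ≤ suc n → map wkJw Γ ⨾ map wkJw Δ ⟹ A ＠ wkW v
              → Principal Γ Rest C w (∀w A ＠ v) → Γ ⨾ Δ ++ Rest ⟹ C ＠ w
    reduce-∀w {A} {v} {Δ} (s≤s sz) D (p∀w s E q) =
      exch (++⁺ˡ Δ q) (cut (size-subP (inst-w s) A sz) D[s] E ↭-refl)
      where
        D[s] : Γ ⨾ Δ ⟹ A [ s /u] ＠ v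
        D[s] = castR (cong (_ ＠_) (inst-w-wkW s _)) (castL (map-inverse (inst-w-wkJw s) Δ)
                 (subD (inst-w s) (incl-inst-w s) D))

    reduce-∃w : ∀ {A v Δ} {s : World k} → size (∃w A) ≤ suc n → Γ ⨾ Δ ⟹ A [ s /u] ＠ v
              → Principal Γ Rest C w (∃w A ＠ v) → Γ ⨾ Δ ++ Rest ⟹ C ＠ w
    reduce-∃w {A} {v} {Δ} {s} (s≤s sz) D (p∃w {Δ = Δ'} E q) =
      exch (++⁺ˡ Δ q) (cut (size-subP (inst-w s) A sz) D E[s] ↭-refl)
      where
        E[s] : Γ ⨾ A [ s /u] ＠ v ∷ Δ' ⟹ C ＠ w
        E[s] = castR (inst-w-wkJw s (C ＠ w))
                 (castL (cong₂ (λ a b → _ ＠ a ∷ b) (inst-w-wkW s _) (map-inverse (inst-w-wkJw s) Δ'))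
                   (subD (inst-w s) (incl-inst-w s) E))

    reduce-at : ∀ {A u v Δ} → size (A at u) ≤ suc n → Γ ⨾ Δ ⟹ A ＠ u
              → Principal Γ Rest C w ((A at u) ＠ v) → Γ ⨾ Δ ++ Rest ⟹ C ＠ w
    reduce-at {Δ = Δ} (s≤s sz) D (pat E q) = exch (++⁺ˡ Δ q) (cut sz D E ↭-refl)

    reduce-↓ : ∀ {A v Δ} → size (↓ A) ≤ suc n → Γ ⨾ Δ ⟹ A [ v /u] ＠ v
             → Principal Γ Rest C w ((↓ A) ＠ v) → Γ ⨾ Δ ++ Rest ⟹ C ＠ w
    reduce-↓ {A} {v} {Δ} (s≤s sz) D (p↓ E q) = exch (++⁺ˡ Δ q) (cut (size-subP (inst-w v) A sz) D E ↭-refl)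

  -- Moving the cut formula across a binder of the right premise (the left premise is
  -- weakened) or of the left premise (the right premise is weakened).
  residual-wkt : ∀ {m k m' k'} (θ : Sub m k m' k') Δ (R : List (Judg m' k'))
               → map (subJ (wkt ⊙ θ)) Δ ++ map wkJt R ≡ map wkJt (map (subJ θ) Δ ++ R)
  residual-wkt θ Δ R = trans (cong (_++ _) (map-fuse (wkt-⊙ θ) Δ)) (sym (map-++ wkJt (map (subJ θ) Δ) R))

  residual-wkw : ∀ {m k m' k'} (θ : Sub m k m' k') Δ (R : List (Judg m' k'))
               → map (subJ (wkw ⊙ θ)) Δ ++ map wkJw R ≡ map wkJw (map (subJ θ) Δ ++ R)
  residual-wkw θ Δ R = trans (cong (_++ _) (map-fuse (wkw-⊙ θ) Δ)) (sym (map-++ wkJw (map (subJ θ) Δ) R))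

  residual-↑t : ∀ {m k m' k'} (θ : Sub m k m' k') Δ (R : List (Judg m' k'))
              → map (subJ (↑t θ)) (map wkJt Δ) ++ map wkJt R ≡ map wkJt (map (subJ θ) Δ ++ R)
  residual-↑t θ Δ R = trans (cong (_++ _) (map-commute (↑t-wkJt θ) Δ)) (sym (map-++ wkJt (map (subJ θ) Δ) R))

  residual-↑w : ∀ {m k m' k'} (θ : Sub m k m' k') Δ (R : List (Judg m' k'))
              → map (subJ (↑w θ)) (map wkJw Δ) ++ map wkJw R ≡ map wkJw (map (subJ θ) Δ ++ R)
  residual-↑w θ Δ R = trans (cong (_++ _) (map-commute (↑w-wkJw θ) Δ)) (sym (map-++ wkJw (map (subJ θ) Δ) R))

  located-↑t : ∀ {m₁ k₁ m₂ k₂ m k} (θ₁ : Sub m₁ k₁ m k) (θ₂ : Sub m₂ k₂ m k) Δ K {R}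
             → map (subJ θ₂) Δ ↭ subJ θ₁ K ∷ R
             → map (subJ (↑t θ₂)) (map wkJt Δ) ↭ subJ (wkt ⊙ θ₁) K ∷ map wkJt R
  located-↑t θ₁ θ₂ Δ K p =
    ↭-trans (↭-reflexive (map-commute (↑t-wkJt θ₂) Δ))
      (↭-trans (map⁺ wkJt p) (↭-reflexive (cong (_∷ _) (sym (wkt-⊙ θ₁ K)))))

  located-↑w : ∀ {m₁ k₁ m₂ k₂ m k} (θ₁ : Sub m₁ k₁ m k) (θ₂ : Sub m₂ k₂ m k) Δ K {R}
             → map (subJ θ₂) Δ ↭ subJ θ₁ K ∷ R
             → map (subJ (↑w θ₂)) (map wkJw Δ) ↭ subJ (wkw ⊙ θ₁) K ∷ map wkJw R
  located-↑w θ₁ θ₂ Δ K p =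
    ↭-trans (↭-reflexive (map-commute (↑w-wkJw θ₂) Δ))
      (↭-trans (map⁺ wkJw p) (↭-reflexive (cong (_∷ _) (sym (wkw-⊙ θ₁ K)))))

  located-wkt : ∀ {m₁ k₁ m₂ k₂ m k} (θ₁ : Sub m₁ k₁ m k) (θ₂ : Sub m₂ k₂ m k) Δ K {R}
              → map (subJ θ₂) Δ ↭ subJ θ₁ K ∷ R
              → map (subJ (wkt ⊙ θ₂)) Δ ↭ subJ (↑t θ₁) (wkJt K) ∷ map wkJt R
  located-wkt θ₁ θ₂ Δ K p =
    ↭-trans (↭-reflexive (map-fuse (wkt-⊙ θ₂) Δ))
      (↭-trans (map⁺ wkJt p) (↭-reflexive (cong (_∷ _) (sym (↑t-wkJt θ₁ K)))))

  located-wkw : ∀ {m₁ k₁ m₂ k₂ m k} (θ₁ : Sub m₁ k₁ m k) (θ₂ : Sub m₂ k₂ m k) Δ K {R}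
              → map (subJ θ₂) Δ ↭ subJ θ₁ K ∷ R
              → map (subJ (wkw ⊙ θ₂)) Δ ↭ subJ (↑w θ₁) (wkJw K) ∷ map wkJw R
  located-wkw θ₁ θ₂ Δ K p =
    ↭-trans (↭-reflexive (map-fuse (wkw-⊙ θ₂) Δ))
      (↭-trans (map⁺ wkJw p) (↭-reflexive (cong (_∷ _) (sym (↑w-wkJw θ₁ K)))))

  -- A left rule of the right premise acting on a side formula Y of Rest commutes with the
  -- cut: cut into its premise (which has the rule's new formula X in the middle) first.
  commute : ∀ {m k} {Γ : List (Judg m k)} (Δ₁ : List (Judg m k)) {Y Rest R' J}
          → Rest ↭ Y ∷ R' → Γ ⨾ Y ∷ (Δ₁ ++ R') ⟹ J → Γ ⨾ Δ₁ ++ Rest ⟹ J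
  commute Δ₁ q d = exch (↭-restore Δ₁ q) d

  toFront : ∀ {m k} {Γ : List (Judg m k)} (Δ₁ : List (Judg m k)) {X R' J}
          → Γ ⨾ Δ₁ ++ X ∷ R' ⟹ J → Γ ⨾ X ∷ (Δ₁ ++ R') ⟹ J
  toFront Δ₁ = exch (shift _ Δ₁ _)

  jsize : ∀ {m k} → Judg m k → ℕ
  jsize (A ＠ u) = size A

  -- An unrestricted hypothesis that may be cut away: derivable with no linear resources,
  -- and small enough for the induction hypothesis.
  record Cutable (n : ℕ) {m k : ℕ} (Γ : List (Judg m k)) (K : Judg m k) : Set c where
    constructor cutable
    field
      small      : jsize K ≤ n
      derivation : Γ ⨾ [] ⟹ K

  cutable-wkt : ∀ {n m k} {Γ : List (Judg m k)} {K} → Cutable n Γ K → Cutable n (map wkJt Γ) (wkJt K)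
  cutable-wkt {K = A ＠ u} (cutable sz D) = cutable (size-subP wkt A sz) (weaken-t D)

  cutable-wkw : ∀ {n m k} {Γ : List (Judg m k)} {K} → Cutable n Γ K → Cutable n (map wkJw Γ) (wkJw K)
  cutable-wkw {K = A ＠ u} (cutable sz D) = cutable (size-subP wkw A sz) (weaken-w D)

  cutable-∷ : ∀ {n m k} {Γ : List (Judg m k)} {K K'} → Cutable n Γ K → Cutable n (K' ∷ Γ) K
  cutable-∷ (cutable sz D) = cutable sz (weaken-∷ D)

  CutHyp : ℕ → ∀ {m k} → List (Judg m k) → Judg m k → Set c
  CutHyp n Γ K = K ∈ Γ ⊎ Cutable n Γ K

  cutHyp-wkt : ∀ {n m k} {Γ : List (Judg m k)} {K} → CutHyp n Γ K → CutHyp n (map wkJt Γ) (wkJt K)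
  cutHyp-wkt (inj₁ K∈) = inj₁ (∈-map⁺ wkJt K∈)
  cutHyp-wkt (inj₂ cK) = inj₂ (cutable-wkt cK)

  cutHyp-wkw : ∀ {n m k} {Γ : List (Judg m k)} {K} → CutHyp n Γ K → CutHyp n (map wkJw Γ) (wkJw K)
  cutHyp-wkw (inj₁ K∈) = inj₁ (∈-map⁺ wkJw K∈)
  cutHyp-wkw (inj₂ cK) = inj₂ (cutable-wkw cK)

  cutHyp-∷ : ∀ {n m k} {Γ : List (Judg m k)} {K K'} → CutHyp n Γ K → CutHyp n (K' ∷ Γ) K
  cutHyp-∷ (inj₁ K∈) = inj₁ (there K∈)
  cutHyp-∷ (inj₂ cK) = inj₂ (cutable-∷ cK)

  mutual
    -- usable hypotheses while discharging a cut-able one: using it is a linear cut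
    cutHyps : ℕ → HypStructure
    cutHyps n = record
      { Hyp = CutHyp n ; hyp-wkt = cutHyp-wkt ; hyp-wkw = cutHyp-wkw
      ; hyp-∷ = cutHyp-∷ ; hyp-hd = inj₁ (here refl) ; use = useCut n }

    useCut : ∀ n {m k} {Γ Δ : List (Judg m k)} {K C w} → CutHyp n Γ K → Γ ⨾ K ∷ Δ ⟹ C ＠ w → Γ ⨾ Δ ⟹ C ＠ w
    useCut n (inj₁ K∈) E = copyJ K∈ E
    useCut n {K = A ＠ u} (inj₂ (cutable sz D)) E = cut n sz D E ↭-refl

    discharge : ∀ n {m k} {Γ Δ : List (Judg m k)} {K C w}
              → Cutable n Γ K → (K ∷ Γ) ⨾ Δ ⟹ C ＠ w → Γ ⨾ Δ ⟹ C ＠ w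
    discharge n {Γ = Γ} {Δ} {K} {C} {w} cK E =
      castR (subJ-id (C ＠ w)) (castL (map-subJ-id Δ) (Substitution.substitute (cutHyps n) idS hyp E))
      where
        hyp : Substitution.Maps (cutHyps n) idS (K ∷ Γ) Γ
        hyp (here refl) = inj₂ (subst (Cutable n Γ) (sym (subJ-id K)) cK)
        hyp (there J∈)  = inj₁ (incl-id J∈)

    cut : ∀ n → CutUpTo n
    cut n {Δ₁ = Δ₁} {Δ₂} {Rest} {A} {u} {C} {w} sz D E p =
      castR (subJ-id (C ＠ w)) (castL (cong (_++ Rest) (map-subJ-id Δ₁))
        (cutR n idS idS sz D incl-id E incl-id
          (↭-trans (↭-reflexive (map-subJ-id Δ₂)) (↭-trans p (↭-reflexive (cong (_∷ Rest) (sym (subJ-id (A ＠ u)))))))))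

    -- Induction on the right premise E: commute the cut upwards until the cut formula
    -- becomes principal, then hand over to cutL.
    cutR : ∀ (n : ℕ) {m₁ k₁ m₂ k₂ m k} (θ₁ : Sub m₁ k₁ m k) (θ₂ : Sub m₂ k₂ m k)
             {Γ₁ Δ₁ A u} {Γ₂ Δ₂ C w} {Γ : List (Judg m k)} {Rest}
         → size A ≤ n
         → Γ₁ ⨾ Δ₁ ⟹ A ＠ u → Incl θ₁ Γ₁ Γ
         → Γ₂ ⨾ Δ₂ ⟹ C ＠ w → Incl θ₂ Γ₂ Γ
         → map (subJ θ₂) Δ₂ ↭ subJ θ₁ (A ＠ u) ∷ Rest
         → Γ ⨾ map (subJ θ₁) Δ₁ ++ Rest ⟹ subJ θ₂ (C ＠ w)
    cutR n θ₁ θ₂ sz D g₁ (exch q E) g₂ p = cutR n θ₁ θ₂ sz D g₁ E g₂ (↭-trans (map⁺ (subJ θ₂) q) p)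
    cutR n θ₁ θ₂ sz D g₁ init g₂ p with ↭-singleton p
    ... | eq , refl = castL (sym (++-identityʳ _)) (castR (sym eq) (subD θ₁ g₁ D))
    cutR n θ₁ θ₂ {Δ₁ = Δ₁} sz D g₁ (copy x E) g₂ p =
      copy (g₂ x) (toFront (map (subJ θ₁) Δ₁) (cutR n θ₁ θ₂ sz D g₁ E g₂ (↭-under _ p)))
    cutR n θ₁ θ₂ {Δ₁ = Δ₁} sz D g₁ (⊗R {Δ = Δa} {Δ' = Δb} E₁ E₂) g₂ p
      with ↭-split++ (map (subJ θ₂) Δa) (↭-trans (↭-reflexive (sym (map-++ (subJ θ₂) Δa Δb))) p)
    ... | inj₁ (R₁ , q₁ , q₂) =
      exch (↭-trans (↭-assoc (map (subJ θ₁) Δ₁) R₁ _) (++⁺ˡ (map (subJ θ₁) Δ₁) (↭-sym q₂)))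
        (⊗R (cutR n θ₁ θ₂ sz D g₁ E₁ g₂ q₁) (subD θ₂ g₂ E₂))
    ... | inj₂ (R₂ , q₁ , q₂) =
      exch (↭-trans (shifts (map (subJ θ₂) Δa) (map (subJ θ₁) Δ₁)) (++⁺ˡ (map (subJ θ₁) Δ₁) (↭-sym q₂)))
        (⊗R (subD θ₂ g₂ E₁) (cutR n θ₁ θ₂ sz D g₁ E₂ g₂ q₁))
    cutR n θ₁ θ₂ {Δ₁ = Δ₁} sz D g₁ E@(⊗L E') g₂ p with ↭-head p
    ... | inj₁ (eq , q) = cutL n θ₁ θ₂ sz D g₁ E g₂ p (subst (Principal _ _ _ _) eq (p⊗ (subD θ₂ g₂ E') q))
    ... | inj₂ (R' , q₁ , q₂) =
      commute (map (subJ θ₁) Δ₁) q₂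
        (⊗L (exch (shift₂ (map (subJ θ₁) Δ₁) _ _ R') (cutR n θ₁ θ₂ sz D g₁ E' g₂ (↭-under₂ _ _ q₁))))
    cutR n θ₁ θ₂ sz D g₁ 𝟏R g₂ p = ⊥-elim (¬[]↭∷ p)
    cutR n θ₁ θ₂ {Δ₁ = Δ₁} sz D g₁ E@(𝟏L E') g₂ p with ↭-head p
    ... | inj₁ (eq , q) = cutL n θ₁ θ₂ sz D g₁ E g₂ p (subst (Principal _ _ _ _) eq (p𝟏 (subD θ₂ g₂ E') q))
    ... | inj₂ (R' , q₁ , q₂) = commute (map (subJ θ₁) Δ₁) q₂ (𝟏L (cutR n θ₁ θ₂ sz D g₁ E' g₂ q₁))
    cutR n θ₁ θ₂ {Δ₁ = Δ₁} sz D g₁ (⊸R E) g₂ p =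
      ⊸R (toFront (map (subJ θ₁) Δ₁) (cutR n θ₁ θ₂ sz D g₁ E g₂ (↭-under _ p)))
    cutR n θ₁ θ₂ {Δ₁ = Δ₁} sz D g₁ E@(⊸L {Δ = Δa} {Δ' = Δb} E₁ E₂) g₂ p with ↭-head p
    ... | inj₁ (eq , q) =
      cutL n θ₁ θ₂ sz D g₁ E g₂ p (subst (Principal _ _ _ _) eq
        (p⊸ (subD θ₂ g₂ E₁) (subD θ₂ g₂ E₂) (↭-trans (↭-reflexive (sym (map-++ (subJ θ₂) Δa Δb))) q)))
    ... | inj₂ (R' , q₁ , q₂) with ↭-split++ (map (subJ θ₂) Δa) (↭-trans (↭-reflexive (sym (map-++ (subJ θ₂) Δa Δb))) q₁)
    ...   | inj₁ (R₁ , r₁ , r₂) =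
      commute (map (subJ θ₁) Δ₁) q₂
        (exch (prep _ (↭-trans (↭-assoc (map (subJ θ₁) Δ₁) R₁ _) (++⁺ˡ (map (subJ θ₁) Δ₁) (↭-sym r₂))))
          (⊸L (cutR n θ₁ θ₂ sz D g₁ E₁ g₂ r₁) (subD θ₂ g₂ E₂)))
    ...   | inj₂ (R₂ , r₁ , r₂) =
      commute (map (subJ θ₁) Δ₁) q₂
        (exch (prep _ (↭-trans (shifts (map (subJ θ₂) Δa) (map (subJ θ₁) Δ₁)) (++⁺ˡ (map (subJ θ₁) Δ₁) (↭-sym r₂))))
          (⊸L (subD θ₂ g₂ E₁) (toFront (map (subJ θ₁) Δ₁) (cutR n θ₁ θ₂ sz D g₁ E₂ g₂ (↭-under _ r₁)))))
    cutR n θ₁ θ₂ sz D g₁ ⊤R g₂ p = ⊤R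
    cutR n θ₁ θ₂ sz D g₁ (&R E₁ E₂) g₂ p = &R (cutR n θ₁ θ₂ sz D g₁ E₁ g₂ p) (cutR n θ₁ θ₂ sz D g₁ E₂ g₂ p)
    cutR n θ₁ θ₂ {Δ₁ = Δ₁} sz D g₁ E@(&L₁ E') g₂ p with ↭-head p
    ... | inj₁ (eq , q) = cutL n θ₁ θ₂ sz D g₁ E g₂ p (subst (Principal _ _ _ _) eq (p&₁ (subD θ₂ g₂ E') q))
    ... | inj₂ (R' , q₁ , q₂) =
      commute (map (subJ θ₁) Δ₁) q₂ (&L₁ (toFront (map (subJ θ₁) Δ₁) (cutR n θ₁ θ₂ sz D g₁ E' g₂ (↭-under _ q₁))))
    cutR n θ₁ θ₂ {Δ₁ = Δ₁} sz D g₁ E@(&L₂ E') g₂ p with ↭-head p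
    ... | inj₁ (eq , q) = cutL n θ₁ θ₂ sz D g₁ E g₂ p (subst (Principal _ _ _ _) eq (p&₂ (subD θ₂ g₂ E') q))
    ... | inj₂ (R' , q₁ , q₂) =
      commute (map (subJ θ₁) Δ₁) q₂ (&L₂ (toFront (map (subJ θ₁) Δ₁) (cutR n θ₁ θ₂ sz D g₁ E' g₂ (↭-under _ q₁))))
    cutR n θ₁ θ₂ sz D g₁ (⊕R₁ E) g₂ p = ⊕R₁ (cutR n θ₁ θ₂ sz D g₁ E g₂ p)
    cutR n θ₁ θ₂ sz D g₁ (⊕R₂ E) g₂ p = ⊕R₂ (cutR n θ₁ θ₂ sz D g₁ E g₂ p)
    cutR n θ₁ θ₂ {Δ₁ = Δ₁} sz D g₁ E@(⊕L E₁ E₂) g₂ p with ↭-head p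
    ... | inj₁ (eq , q) =
      cutL n θ₁ θ₂ sz D g₁ E g₂ p (subst (Principal _ _ _ _) eq (p⊕ (subD θ₂ g₂ E₁) (subD θ₂ g₂ E₂) q))
    ... | inj₂ (R' , q₁ , q₂) =
      commute (map (subJ θ₁) Δ₁) q₂
        (⊕L (toFront (map (subJ θ₁) Δ₁) (cutR n θ₁ θ₂ sz D g₁ E₁ g₂ (↭-under _ q₁)))
            (toFront (map (subJ θ₁) Δ₁) (cutR n θ₁ θ₂ sz D g₁ E₂ g₂ (↭-under _ q₁))))
    cutR n θ₁ θ₂ {Δ₁ = Δ₁} sz D g₁ E@𝟎L g₂ p with ↭-head p
    ... | inj₁ (eq , q) = cutL n θ₁ θ₂ sz D g₁ E g₂ p (subst (Principal _ _ _ _) eq p𝟎)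
    ... | inj₂ (R' , q₁ , q₂) = commute (map (subJ θ₁) Δ₁) q₂ 𝟎L
    cutR n θ₁ θ₂ {Δ₁ = Δ₁} {A = A} {u = u} {Rest = Rest} sz D g₁ (∀tR {Δ = Δ₂} E) g₂ p =
      ∀tR (castL (residual-wkt θ₁ Δ₁ Rest)
        (cutR n (wkt ⊙ θ₁) (↑t θ₂) sz D (incl-wkt θ₁ g₁) E (incl-↑t θ₂ g₂) (located-↑t θ₁ θ₂ Δ₂ (A ＠ u) p)))
    cutR n θ₁ θ₂ {Δ₁ = Δ₁} sz D g₁ E@(∀tL {A = A'} t E') g₂ p with ↭-head p
    ... | inj₁ (eq , q) =
      cutL n θ₁ θ₂ sz D g₁ E g₂ p (subst (Principal _ _ _ _) eq
        (p∀t (substT (σ θ₂) t) (castL (cong (λ X → X ＠ _ ∷ _) (subP-inst-t θ₂ A' t)) (subD θ₂ g₂ E')) q))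
    ... | inj₂ (R' , q₁ , q₂) =
      commute (map (subJ θ₁) Δ₁) q₂ (∀tL (substT (σ θ₂) t) (castL (cong (λ X → X ＠ _ ∷ _) (subP-inst-t θ₂ A' t))
        (toFront (map (subJ θ₁) Δ₁) (cutR n θ₁ θ₂ sz D g₁ E' g₂ (↭-under _ q₁)))))
    cutR n θ₁ θ₂ sz D g₁ (∃tR {A = A'} t E) g₂ p =
      ∃tR (substT (σ θ₂) t) (castR (cong (_＠ _) (subP-inst-t θ₂ A' t)) (cutR n θ₁ θ₂ sz D g₁ E g₂ p))
    cutR n θ₁ θ₂ {Δ₁ = Δ₁} {A = A} {u = u} sz D g₁ E@(∃tL {Δ = Δt} {C = C'} {w = w'} E') g₂ p with ↭-head p
    ... | inj₁ (eq , q) =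
      cutL n θ₁ θ₂ sz D g₁ E g₂ p (subst (Principal _ _ _ _) eq
        (p∃t (castR (↑t-wkJt θ₂ (C' ＠ w')) (castL (cong (_ ∷_) (map-commute (↑t-wkJt θ₂) Δt))
          (subD (↑t θ₂) (incl-↑t θ₂ g₂) E'))) q))
    ... | inj₂ (R' , q₁ , q₂) =
      commute (map (subJ θ₁) Δ₁) q₂ (∃tL (castR (↑t-wkJt θ₂ (C' ＠ w')) (castL (cong (_ ∷_) (residual-wkt θ₁ Δ₁ R'))
        (toFront (map (subJ (wkt ⊙ θ₁)) Δ₁)
          (cutR n (wkt ⊙ θ₁) (↑t θ₂) sz D (incl-wkt θ₁ g₁) E' (incl-↑t θ₂ g₂)
            (↭-under _ (located-↑t θ₁ θ₂ Δt (A ＠ u) q₁)))))))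
    cutR n θ₁ θ₂ {Δ₁ = Δ₁} {A = A} {u = u} {Rest = Rest} sz D g₁ (∀wR {Δ = Δ₂} {w = w'} E) g₂ p =
      ∀wR (castR (cong (_ ＠_) (↑w-wkW θ₂ w')) (castL (residual-wkw θ₁ Δ₁ Rest)
        (cutR n (wkw ⊙ θ₁) (↑w θ₂) sz D (incl-wkw θ₁ g₁) E (incl-↑w θ₂ g₂) (located-↑w θ₁ θ₂ Δ₂ (A ＠ u) p))))
    cutR n θ₁ θ₂ {Δ₁ = Δ₁} sz D g₁ E@(∀wL {A = A'} v E') g₂ p with ↭-head p
    ... | inj₁ (eq , q) =
      cutL n θ₁ θ₂ sz D g₁ E g₂ p (subst (Principal _ _ _ _) eq
        (p∀w (subW θ₂ v) (castL (cong (λ X → X ＠ _ ∷ _) (subP-inst-w θ₂ A' v)) (subD θ₂ g₂ E')) q))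
    ... | inj₂ (R' , q₁ , q₂) =
      commute (map (subJ θ₁) Δ₁) q₂ (∀wL (subW θ₂ v) (castL (cong (λ X → X ＠ _ ∷ _) (subP-inst-w θ₂ A' v))
        (toFront (map (subJ θ₁) Δ₁) (cutR n θ₁ θ₂ sz D g₁ E' g₂ (↭-under _ q₁)))))
    cutR n θ₁ θ₂ sz D g₁ (∃wR {A = A'} v E) g₂ p =
      ∃wR (subW θ₂ v) (castR (cong (_＠ _) (subP-inst-w θ₂ A' v)) (cutR n θ₁ θ₂ sz D g₁ E g₂ p))
    cutR n θ₁ θ₂ {Δ₁ = Δ₁} {A = A} {u = u} sz D g₁ E@(∃wL {Δ = Δt} {u = u'} {C = C'} {w = w'} E') g₂ p with ↭-head p
    ... | inj₁ (eq , q) =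
      cutL n θ₁ θ₂ sz D g₁ E g₂ p (subst (Principal _ _ _ _) eq
        (p∃w (castR (↑w-wkJw θ₂ (C' ＠ w')) (castL (cong₂ (λ a b → _ ＠ a ∷ b) (↑w-wkW θ₂ u') (map-commute (↑w-wkJw θ₂) Δt))
          (subD (↑w θ₂) (incl-↑w θ₂ g₂) E'))) q))
    ... | inj₂ (R' , q₁ , q₂) =
      commute (map (subJ θ₁) Δ₁) q₂ (∃wL (castR (↑w-wkJw θ₂ (C' ＠ w'))
        (castL (cong₂ (λ a b → _ ＠ a ∷ b) (↑w-wkW θ₂ u') (residual-wkw θ₁ Δ₁ R'))
          (toFront (map (subJ (wkw ⊙ θ₁)) Δ₁)
            (cutR n (wkw ⊙ θ₁) (↑w θ₂) sz D (incl-wkw θ₁ g₁) E' (incl-↑w θ₂ g₂)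
              (↭-under _ (located-↑w θ₁ θ₂ Δt (A ＠ u) q₁)))))))
    cutR n θ₁ θ₂ sz D g₁ (!R E) g₂ p = ⊥-elim (¬[]↭∷ p)
    cutR n θ₁ θ₂ {Δ₁ = Δ₁} sz D g₁ E@(!L {A = A'} {u = u'} E') g₂ p with ↭-head p
    ... | inj₁ (eq , q) =
      cutL n θ₁ θ₂ sz D g₁ E g₂ p (subst (Principal _ _ _ _) eq (p! (subD θ₂ (incl-∷ θ₂ (A' ＠ u') g₂) E') q))
    ... | inj₂ (R' , q₁ , q₂) =
      commute (map (subJ θ₁) Δ₁) q₂ (!L (cutR n θ₁ θ₂ sz D (λ x → there (g₁ x)) E' (incl-∷ θ₂ (A' ＠ u') g₂) q₁))
    cutR n θ₁ θ₂ sz D g₁ (atR E) g₂ p = atR (cutR n θ₁ θ₂ sz D g₁ E g₂ p)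
    cutR n θ₁ θ₂ {Δ₁ = Δ₁} sz D g₁ E@(atL E') g₂ p with ↭-head p
    ... | inj₁ (eq , q) = cutL n θ₁ θ₂ sz D g₁ E g₂ p (subst (Principal _ _ _ _) eq (pat (subD θ₂ g₂ E') q))
    ... | inj₂ (R' , q₁ , q₂) =
      commute (map (subJ θ₁) Δ₁) q₂ (atL (toFront (map (subJ θ₁) Δ₁) (cutR n θ₁ θ₂ sz D g₁ E' g₂ (↭-under _ q₁))))
    cutR n θ₁ θ₂ sz D g₁ (↓R {A = A'} {w = w'} E) g₂ p =
      ↓R (castR (cong (_＠ _) (subP-inst-w θ₂ A' w')) (cutR n θ₁ θ₂ sz D g₁ E g₂ p))
    cutR n θ₁ θ₂ {Δ₁ = Δ₁} sz D g₁ E@(↓L {A = A'} {v = v'} E') g₂ p with ↭-head p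
    ... | inj₁ (eq , q) =
      cutL n θ₁ θ₂ sz D g₁ E g₂ p (subst (Principal _ _ _ _) eq
        (p↓ (castL (cong (λ X → X ＠ _ ∷ _) (subP-inst-w θ₂ A' v')) (subD θ₂ g₂ E')) q))
    ... | inj₂ (R' , q₁ , q₂) =
      commute (map (subJ θ₁) Δ₁) q₂ (↓L (castL (cong (λ X → X ＠ _ ∷ _) (subP-inst-w θ₂ A' v'))
        (toFront (map (subJ θ₁) Δ₁) (cutR n θ₁ θ₂ sz D g₁ E' g₂ (↭-under _ q₁)))))

    -- Induction on the left premise D, the cut formula being principal in E: commute the
    -- cut upwards through left rules of D; at a right rule, perform the principal reduction.
    cutL : ∀ (n : ℕ) {m₁ k₁ m₂ k₂ m k} (θ₁ : Sub m₁ k₁ m k) (θ₂ : Sub m₂ k₂ m k)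
             {Γ₁ Δ₁ A u} {Γ₂ Δ₂ C w} {Γ : List (Judg m k)} {Rest}
         → size A ≤ n
         → Γ₁ ⨾ Δ₁ ⟹ A ＠ u → Incl θ₁ Γ₁ Γ
         → Γ₂ ⨾ Δ₂ ⟹ C ＠ w → Incl θ₂ Γ₂ Γ
         → map (subJ θ₂) Δ₂ ↭ subJ θ₁ (A ＠ u) ∷ Rest
         → Principal Γ Rest (subP θ₂ C) (subW θ₂ w) (subJ θ₁ (A ＠ u))
         → Γ ⨾ map (subJ θ₁) Δ₁ ++ Rest ⟹ subJ θ₂ (C ＠ w)
    cutL n θ₁ θ₂ {Rest = Rest} sz (exch q D) g₁ E g₂ p pr =
      exch (++⁺ʳ Rest (map⁺ (subJ θ₁) q)) (cutR n θ₁ θ₂ sz D g₁ E g₂ p)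
    cutL n θ₁ θ₂ sz (copy x D) g₁ E g₂ p pr = copy (g₁ x) (cutR n θ₁ θ₂ sz D g₁ E g₂ p)
    cutL n θ₁ θ₂ sz (⊗L D) g₁ E g₂ p pr = ⊗L (cutR n θ₁ θ₂ sz D g₁ E g₂ p)
    cutL n θ₁ θ₂ sz (𝟏L D) g₁ E g₂ p pr = 𝟏L (cutR n θ₁ θ₂ sz D g₁ E g₂ p)
    cutL n θ₁ θ₂ {Rest = Rest} sz (⊸L {Δ = Δa} {Δ' = Δb} D₁ D₂) g₁ E g₂ p pr =
      castL (cong (_ ∷_) (trans (sym (++-assoc (map (subJ θ₁) Δa) (map (subJ θ₁) Δb) Rest))
                                (cong (_++ Rest) (sym (map-++ (subJ θ₁) Δa Δb)))))
        (⊸L (subD θ₁ g₁ D₁) (cutR n θ₁ θ₂ sz D₂ g₁ E g₂ p))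
    cutL n θ₁ θ₂ sz (&L₁ D) g₁ E g₂ p pr = &L₁ (cutR n θ₁ θ₂ sz D g₁ E g₂ p)
    cutL n θ₁ θ₂ sz (&L₂ D) g₁ E g₂ p pr = &L₂ (cutR n θ₁ θ₂ sz D g₁ E g₂ p)
    cutL n θ₁ θ₂ sz (⊕L D₁ D₂) g₁ E g₂ p pr = ⊕L (cutR n θ₁ θ₂ sz D₁ g₁ E g₂ p) (cutR n θ₁ θ₂ sz D₂ g₁ E g₂ p)
    cutL n θ₁ θ₂ sz 𝟎L g₁ E g₂ p pr = 𝟎L
    cutL n θ₁ θ₂ sz (∀tL {A = A'} t D) g₁ E g₂ p pr =
      ∀tL (substT (σ θ₁) t) (castL (cong (λ X → X ＠ _ ∷ _) (subP-inst-t θ₁ A' t)) (cutR n θ₁ θ₂ sz D g₁ E g₂ p))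
    cutL n θ₁ θ₂ {Δ₂ = Δ₂} {C = C} {w = w} {Rest = Rest} sz (∃tL {Δ = Δ₁'} {C = A} {w = u} D) g₁ E g₂ p pr =
      ∃tL (castR (wkt-⊙ θ₂ (C ＠ w)) (castL (cong (_ ∷_) (residual-↑t θ₁ Δ₁' Rest))
        (cutR n (↑t θ₁) (wkt ⊙ θ₂) (size-subP wkt A sz) D (incl-↑t θ₁ g₁) E (incl-wkt θ₂ g₂)
          (located-wkt θ₁ θ₂ Δ₂ (A ＠ u) p))))
    cutL n θ₁ θ₂ sz (∀wL {A = A'} v D) g₁ E g₂ p pr =
      ∀wL (subW θ₁ v) (castL (cong (λ X → X ＠ _ ∷ _) (subP-inst-w θ₁ A' v)) (cutR n θ₁ θ₂ sz D g₁ E g₂ p))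
    cutL n θ₁ θ₂ {Δ₂ = Δ₂} {C = C} {w = w} {Rest = Rest} sz (∃wL {Δ = Δ₁'} {u = u'} {C = A} {w = u} D) g₁ E g₂ p pr =
      ∃wL (castR (wkw-⊙ θ₂ (C ＠ w)) (castL (cong₂ (λ a b → _ ＠ a ∷ b) (↑w-wkW θ₁ u') (residual-↑w θ₁ Δ₁' Rest))
        (cutR n (↑w θ₁) (wkw ⊙ θ₂) (size-subP wkw A sz) D (incl-↑w θ₁ g₁) E (incl-wkw θ₂ g₂)
          (located-wkw θ₁ θ₂ Δ₂ (A ＠ u) p))))
    cutL n θ₁ θ₂ sz (!L {A = A'} {u = u'} D) g₁ E g₂ p pr =
      !L (cutR n θ₁ θ₂ sz D (incl-∷ θ₁ (A' ＠ u') g₁) E (λ x → there (g₂ x)) p)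
    cutL n θ₁ θ₂ sz (atL D) g₁ E g₂ p pr = atL (cutR n θ₁ θ₂ sz D g₁ E g₂ p)
    cutL n θ₁ θ₂ sz (↓L {A = A'} {v = v} D) g₁ E g₂ p pr =
      ↓L (castL (cong (λ X → X ＠ _ ∷ _) (subP-inst-w θ₁ A' v)) (cutR n θ₁ θ₂ sz D g₁ E g₂ p))
    cutL n θ₁ θ₂ sz init g₁ E g₂ p ()
    cutL n θ₁ θ₂ sz ⊤R g₁ E g₂ p ()
    cutL (suc n) θ₁ θ₂ {A = A} {Rest = Rest} sz (⊗R {Δ = Δa} {Δ' = Δb} D₁ D₂) g₁ E g₂ p pr =
      castL (cong (_++ Rest) (sym (map-++ (subJ θ₁) Δa Δb)))
        (reduce-⊗ (cut n) (size-subP θ₁ A sz) (subD θ₁ g₁ D₁) (subD θ₁ g₁ D₂) pr)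
    cutL n θ₁ θ₂ sz 𝟏R g₁ E g₂ p pr = reduce-𝟏 pr
    cutL (suc n) θ₁ θ₂ {A = A} sz (⊸R D) g₁ E g₂ p pr = reduce-⊸ (cut n) (size-subP θ₁ A sz) (subD θ₁ g₁ D) pr
    cutL (suc n) θ₁ θ₂ {A = A} sz (&R D₁ D₂) g₁ E g₂ p pr =
      reduce-& (cut n) (size-subP θ₁ A sz) (subD θ₁ g₁ D₁) (subD θ₁ g₁ D₂) pr
    cutL (suc n) θ₁ θ₂ {A = A} sz (⊕R₁ D) g₁ E g₂ p pr = reduce-⊕₁ (cut n) (size-subP θ₁ A sz) (subD θ₁ g₁ D) pr
    cutL (suc n) θ₁ θ₂ {A = A} sz (⊕R₂ D) g₁ E g₂ p pr = reduce-⊕₂ (cut n) (size-subP θ₁ A sz) (subD θ₁ g₁ D) pr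
    cutL (suc n) θ₁ θ₂ {Δ₁ = Δ₁} {A = A} sz (∀tR D) g₁ E g₂ p pr =
      reduce-∀t (cut n) (size-subP θ₁ A sz)
        (castL (map-commute (↑t-wkJt θ₁) Δ₁) (subD (↑t θ₁) (incl-↑t θ₁ g₁) D)) pr
    cutL (suc n) θ₁ θ₂ {A = A} sz (∃tR {A = A'} t D) g₁ E g₂ p pr =
      reduce-∃t (cut n) (size-subP θ₁ A sz) (castR (cong (_＠ _) (subP-inst-t θ₁ A' t)) (subD θ₁ g₁ D)) pr
    cutL (suc n) θ₁ θ₂ {Δ₁ = Δ₁} {A = A} sz (∀wR {w = w'} D) g₁ E g₂ p pr =
      reduce-∀w (cut n) (size-subP θ₁ A sz)
        (castR (cong (_ ＠_) (↑w-wkW θ₁ w')) (castL (map-commute (↑w-wkJw θ₁) Δ₁) (subD (↑w θ₁) (incl-↑w θ₁ g₁) D))) pr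
    cutL (suc n) θ₁ θ₂ {A = A} sz (∃wR {A = A'} s D) g₁ E g₂ p pr =
      reduce-∃w (cut n) (size-subP θ₁ A sz) (castR (cong (_＠ _) (subP-inst-w θ₁ A' s)) (subD θ₁ g₁ D)) pr
    cutL (suc n) θ₁ θ₂ (s≤s sz) (!R {A = A'} D) g₁ E g₂ p (p! E' q) =
      exch q (discharge n (cutable (size-subP θ₁ A' sz) (subD θ₁ g₁ D)) E')
    cutL (suc n) θ₁ θ₂ {A = A} sz (atR D) g₁ E g₂ p pr = reduce-at (cut n) (size-subP θ₁ A sz) (subD θ₁ g₁ D) pr
    cutL (suc n) θ₁ θ₂ {A = A} sz (↓R {A = A'} {w = w'} D) g₁ E g₂ p pr =
      reduce-↓ (cut n) (size-subP θ₁ A sz) (castR (cong (_＠ _) (subP-inst-w θ₁ A' w')) (subD θ₁ g₁ D)) pr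

  linear-cut : ∀ {m k : ℕ} (Γ Δ Δ' : List (Judg m k)) (A C : Prop m k) (u w : World k)
             → Γ ⨾ Δ ⟹ A ＠ u → Γ ⨾ (A ＠ u ∷ Δ') ⟹ C ＠ w → Γ ⨾ Δ ++ Δ' ⟹ C ＠ w
  linear-cut Γ Δ Δ' A C u w D E = cut (size A) ≤-refl D E ↭-refl

  unrestricted-cut : ∀ {m k : ℕ} (Γ Δ : List (Judg m k)) (A C : Prop m k) (u w : World k)
                   → Γ ⨾ [] ⟹ A ＠ u → (A ＠ u ∷ Γ) ⨾ Δ ⟹ C ＠ w → Γ ⨾ Δ ⟹ C ＠ w
  unrestricted-cut Γ Δ A C u w D E = discharge (size A) (cutable ≤-refl D) E

mainTheorem5 : ∀ {c ℓ : Level} (𝒲 : Monoid c ℓ) (Sg : Signature) → let open HyLL 𝒲 Sg in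
    (∀ {m k : ℕ} (Γ Δ Δ' : List (Judg m k)) (A C : Prop m k) (u w : World k)
       → Γ ⨾ Δ ⟹ A ＠ u
       → Γ ⨾ (A ＠ u ∷ Δ') ⟹ C ＠ w
       → Γ ⨾ Δ ++ Δ' ⟹ C ＠ w)
    ×
    (∀ {m k : ℕ} (Γ Δ : List (Judg m k)) (A C : Prop m k) (u w : World k)
       → Γ ⨾ [] ⟹ A ＠ u
       → (A ＠ u ∷ Γ) ⨾ Δ ⟹ C ＠ w
       → Γ ⨾ Δ ⟹ C ＠ w)
mainTheorem5 𝒲 Sg = linear-cut , unrestricted-cut
  where open CutElimination 𝒲 Sg
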